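{- The discrepancy of $\mathcal{DB}_{max}(n)=\overline{\mathcal{D}}_{d}(n)\cdot\mathcal{D}^r_{d'}(n)$, where $d=\lfloor n/2\rfloor+1$ and $d'=\lceil n/2\rceil$, is $\Theta\!\left(\frac{2^n}{\sqrt n}\right)$ as $n\to\infty$.
   Context: The weight of a binary string is its number of $1$s. A necklace is a binary string that is lexicographically smallest among all its rotations. The periodic reduction $\operatorname{pr}(\alpha)$ of $\alpha$ is the shortest prefix $\beta$ of $\alpha$ with $\alpha=\beta^j$ for some $j\ge1$. For $0\le d\le n$, $\mathcal{D}_d(n)$ is the concatenation of $\operatorname{pr}(\alpha)$ over all necklaces $\alpha$ of length $n$ with weight at least $d$, in lexicographic order; $\overline{\mathcal{D}}_d(n)$ is its bitwise complement; $\mathcal{D}^r_d(n)$ is $\mathcal{D}_d(n)$ with its suffix $1^{d-1}$ moved to the front. (The string $\mathcal{DB}_{max}(n)$ is a de Bruijn sequence of order $n$, i.e., a circular binary string of length $2^n$ containing each length-$n$ binary string exactly once as a circular substring.) For a binary string $w$, the discrepancy is $\operatorname{disc}(w)=\max_{u}\big|\,|u|_1-|u|_0\,\big|$ over all circular substrings $u$ of $w$, where $|u|_a$ counts occurrences of $a$ in $u$. -}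

module Defs where

open import Data.Bool using (Bool; true; false; not; _∧_; _∨_; if_then_else_)
open import Data.Nat using (ℕ; zero; suc; _+_; _*_; _∸_; _⊔_; _≤ᵇ_; _≡ᵇ_; ∣_-_∣; ⌊_/2⌋; ⌈_/2⌉)
open import Data.List using (List; []; _∷_; _++_; map; concatMap; filterᵇ; take; drop; length; foldr; upTo; replicate; concat)
open import Relation.Binary.PropositionalEquality using (_≡_)

-- Binary strings: true = 1, false = 0.
BinStr : Set
BinStr = List Bool

weight : BinStr → ℕ
weight [] = 0
weight (true ∷ w) = suc (weight w)
weight (false ∷ w) = weight w

zeros : BinStr → ℕ
zeros [] = 0
zeros (true ∷ w) = zeros w
zeros (false ∷ w) = suc (zeros w)

eqStr : BinStr → BinStr → Bool
eqStr [] [] = true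
eqStr (a ∷ u) (b ∷ v) = (if a then b else not b) ∧ eqStr u v
eqStr _ _ = false

lexLeq : BinStr → BinStr → Bool
lexLeq [] _ = true
lexLeq (_ ∷ _) [] = false
lexLeq (false ∷ u) (true ∷ v) = true
lexLeq (true ∷ u) (false ∷ v) = false
lexLeq (false ∷ u) (false ∷ v) = lexLeq u v
lexLeq (true ∷ u) (true ∷ v) = lexLeq u v

rotate : ℕ → BinStr → BinStr
rotate i w = drop i w ++ take i w

rotations : BinStr → List BinStr
rotations w = map (λ i → rotate i w) (upTo (length w))

isNecklace : BinStr → Bool
isNecklace w = foldr _∧_ true (map (λ r → lexLeq w r) (rotations w))

allStrings : ℕ → List BinStr
allStrings zero = [] ∷ []
allStrings (suc n) = map (false ∷_) (allStrings n) ++ map (true ∷_) (allStrings n)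

power : ℕ → BinStr → BinStr
power j b = concat (replicate j b)

-- does the prefix of length p witness α = β^j (β = take p α) for some j ≥ 1 ?
-- (j is necessarily length α / p when it exists; we test all j ≤ length α)
isPeriodPrefix : BinStr → ℕ → Bool
isPeriodPrefix α p =
  foldr _∨_ false (map (λ j → eqStr (power (suc j) (take p α)) α) (upTo (length α)))

-- periodic reduction: shortest prefix β with α = β^j, j ≥ 1
-- (search prefix lengths 0,1,...,|α|; the full string always works, for α ≠ [])
prSearch : BinStr → List ℕ → BinStr
prSearch α [] = α
prSearch α (p ∷ ps) = if isPeriodPrefix α p then take p α else prSearch α ps

pr : BinStr → BinStr
pr α = prSearch α (upTo (suc (length α)))

-- D_d(n): concatenation of pr(α) over necklaces α of length n with weight ≥ d,
-- in lexicographic order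
D : ℕ → ℕ → BinStr
D d n = concatMap pr (filterᵇ (λ α → isNecklace α ∧ (d ≤ᵇ weight α)) (allStrings n))

complement : BinStr → BinStr
complement = map not

Dbar : ℕ → ℕ → BinStr
Dbar d n = complement (D d n)

-- D^r_d(n): D_d(n) with its suffix of length d-1 (which is 1^{d-1}) moved to the front
Dr : ℕ → ℕ → BinStr
Dr d n = let w = D d n ; k = length w ∸ (d ∸ 1) in drop k w ++ take k w

DBmax : ℕ → BinStr
DBmax n = Dbar (suc ⌊ n /2⌋) n ++ Dr ⌈ n /2⌉ n

circularSubstrings : BinStr → List BinStr
circularSubstrings w =
  concatMap (λ i → map (λ l → take l (drop i (w ++ w))) (upTo (suc (length w))))
            (upTo (length w))

disc : BinStr → ℕ
disc w = foldr _⊔_ 0 (map (λ u → ∣ weight u - zeros u ∣) (circularSubstrings w))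

module Submission where

-- Write N = n + 1, e = ⌊N/2⌋, e' = ⌊n/2⌋ and T = C(n, e) = C(n, e').  We prove
--     T ≤ disc (DB_max N) ≤ T + 4N     and     4^N ≤ 8 N T²,  N T² ≤ 4^N,
-- whence 4^N ≤ 8 N disc² and N disc² ≤ 34 · 4^N for all N ≥ 1.  The file develops:
--  1. Words: rotations, powers, and the periodic reduction pr α, whose length is
--     the least positive rotational period of α.
--  2. Necklace enumeration: the rotation classes of the necklaces of weight ≥ d
--     list every string of length n and weight ≥ d exactly once; so for an additive
--     statistic h (length, ones, zeros), n · h(D_d(n)) sums h over those strings.
--  3. A binomial computation: the ones of D_{e+1}(n+1) exceed its zeros by C(n, e).
--  4. Prefix bounds: for n ≤ 2d, D_d(n) is a concatenation of blocks pr α of length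
--     ≤ n that are at least half ones, so the excess of each prefix lies in
--     [−n, T + n].  Concatenating the complement of one such string with a rotation
--     of another keeps every circular substring within T + 4N, while the first
--     factor alone has imbalance T.
--  5. Central binomial estimates N T² ≍ 4^N from the ratio recurrence of C(2m, m).

open import Defs
open import Data.Bool using (Bool; true; false; not; T; _∧_)
open import Data.Bool.Properties using (T-∧; not-involutive)
open import Data.Unit using (tt)
open import Data.Empty using (⊥-elim)
open import Data.Nat
  using (ℕ; zero; suc; 2+; _+_; _*_; _∸_; _^_; _≤_; _≥_; _<_; _≤?_; z≤n; s≤s; s≤s⁻¹; _≤ᵇ_; _⊓_; _⊔_;
         ∣_-_∣; ⌊_/2⌋; ⌈_/2⌉; NonZero; >-nonZero)
open import Data.Nat.Properties
open import Data.Nat.DivMod using (_%_; _/_; m≡m%n+[m/n]*n; m%n<n)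
open import Data.Nat.Induction using (<-rec)
open import Data.Nat.Combinatorics using (_C_; nCk≡nC[n∸k]; nCn≡1; nC1≡n; k>n⇒nCk≡0; nCk+nC[k+1]≡[n+1]C[k+1])
open import Data.Nat.ListAction using (sum)
open import Data.Nat.ListAction.Properties using (sum-++; sum-↭)
open import Data.Nat.Tactic.RingSolver using (solve-∀)
open import Data.List using (List; []; _∷_; _++_; map; take; drop; length; concat; concatMap; foldr; upTo; applyUpTo; filterᵇ)
open import Data.List.Properties
  using (++-assoc; ++-identityʳ; ++-cancelˡ; ∷-injectiveʳ; length-++; length-map; length-take; length-drop; length-upTo;
         take-all; take-take; take-[]; take-map; drop-all; drop-drop; drop-map; take++drop≡id; map-++; map-∘; map-id;
         map-cong; map-cong-local; map-upTo; concat-map; filter-++)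
open import Data.List.Relation.Unary.Any using (here; there; satisfied)
import Data.List.Relation.Unary.Any.Properties as Any
open import Data.List.Relation.Unary.All as All using (All; []; _∷_; lookup; tabulate)
import Data.List.Relation.Unary.All.Properties as AllProp
import Data.List.Relation.Unary.AllPairs as AllPairs
open import Data.List.Relation.Unary.Unique.Propositional using (Unique)
import Data.List.Relation.Unary.Unique.Propositional.Properties as Unique
open import Data.List.Relation.Binary.Disjoint.Propositional using (Disjoint)
open import Data.List.Membership.Propositional using (_∈_; find; lose)
open import Data.List.Membership.Propositional.Properties
  using (∈-upTo⁺; ∈-upTo⁻; ∈-map⁺; ∈-map⁻; ∈-++⁺ˡ; ∈-++⁺ʳ; ∈-++⁻; ∈-filter⁺; ∈-filter⁻; ∈-concatMap⁺; ∈-concatMap⁻)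
open import Data.List.Membership.Propositional.Properties.WithK using (unique∧set⇒bag)
open import Data.List.Relation.Binary.BagAndSetEquality using (∼bag⇒↭)
open import Data.List.Relation.Binary.Permutation.Propositional using (_↭_)
import Data.List.Relation.Binary.Permutation.Propositional.Properties as Perm
open import Data.Product using (Σ; ∃; _×_; _,_; proj₁; proj₂)
open import Data.Sum using (_⊎_; inj₁; inj₂)
open import Relation.Binary.PropositionalEquality
open import Relation.Nullary using (yes; no; ¬_)
open import Relation.Nullary.Decidable using (T?)
open import Function using (_∘_)
open import Function.Bundles using (Equivalence; mk⇔)
open Equivalence using (to; from)

module _ {A : Set} where

  take-++-≤ : ∀ k (x y : List A) → k ≤ length x → take k (x ++ y) ≡ take k x
  take-++-≤ zero    x       y _       = refl
  take-++-≤ (suc k) (a ∷ x) y (s≤s p) = cong (a ∷_) (take-++-≤ k x y p)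

  drop-++-≤ : ∀ k (x y : List A) → k ≤ length x → drop k (x ++ y) ≡ drop k x ++ y
  drop-++-≤ zero    x       y _       = refl
  drop-++-≤ (suc k) (a ∷ x) y (s≤s p) = drop-++-≤ k x y p

  take-++ : ∀ k (x y : List A) → take k (x ++ y) ≡ take k x ++ take (k ∸ length x) y
  take-++ zero    []      y = refl
  take-++ zero    (a ∷ x) y = refl
  take-++ (suc k) []      y = refl
  take-++ (suc k) (a ∷ x) y = cong (a ∷_) (take-++ k x y)

  take-length-++ : ∀ (x y : List A) → take (length x) (x ++ y) ≡ x
  take-length-++ []      y = refl
  take-length-++ (a ∷ x) y = cong (a ∷_) (take-length-++ x y)

  drop-length-++ : ∀ (x y : List A) → drop (length x) (x ++ y) ≡ y
  drop-length-++ []      y = refl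
  drop-length-++ (a ∷ x) y = drop-length-++ x y

  take-+ : ∀ b a (xs : List A) → take (b + a) xs ≡ take b xs ++ take a (drop b xs)
  take-+ zero    a xs       = refl
  take-+ (suc b) a []       = sym (take-[] a)
  take-+ (suc b) a (x ∷ xs) = cong (x ∷_) (take-+ b a xs)

  length-take-≤ : ∀ k (xs : List A) → k ≤ length xs → length (take k xs) ≡ k
  length-take-≤ k xs k≤ = trans (length-take k xs) (m≤n⇒m⊓n≡m k≤)

record Additive (h : BinStr → ℕ) : Set where
  field
    h-[] : h [] ≡ 0
    h-++ : ∀ x y → h (x ++ y) ≡ h x + h y

length-additive : Additive length
length-additive = record { h-[] = refl ; h-++ = λ x y → length-++ x }

weight-additive : Additive weight
weight-additive = record { h-[] = refl ; h-++ = weight-++ }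
  where
  weight-++ : ∀ x y → weight (x ++ y) ≡ weight x + weight y
  weight-++ []          y = refl
  weight-++ (true ∷ x)  y = cong suc (weight-++ x y)
  weight-++ (false ∷ x) y = weight-++ x y

zeros-additive : Additive zeros
zeros-additive = record { h-[] = refl ; h-++ = zeros-++ }
  where
  zeros-++ : ∀ x y → zeros (x ++ y) ≡ zeros x + zeros y
  zeros-++ []          y = refl
  zeros-++ (true ∷ x)  y = zeros-++ x y
  zeros-++ (false ∷ x) y = cong suc (zeros-++ x y)

module _ {h : BinStr → ℕ} (add : Additive h) where

  open Additive add

  additive-concat : ∀ (ws : List BinStr) → h (concat ws) ≡ sum (map h ws)
  additive-concat []       = h-[]
  additive-concat (w ∷ ws) = trans (h-++ w (concat ws)) (cong (h w +_) (additive-concat ws))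

  additive-power : ∀ m b → h (power m b) ≡ m * h b
  additive-power zero    b = h-[]
  additive-power (suc m) b = trans (h-++ b (power m b)) (cong (h b +_) (additive-power m b))

  additive-rotate : ∀ k α → h (rotate k α) ≡ h α
  additive-rotate k α = begin
      h (drop k α ++ take k α)    ≡⟨ h-++ (drop k α) (take k α) ⟩
      h (drop k α) + h (take k α) ≡⟨ +-comm (h (drop k α)) _ ⟩
      h (take k α) + h (drop k α) ≡⟨ sym (h-++ (take k α) (drop k α)) ⟩
      h (take k α ++ drop k α)    ≡⟨ cong h (take++drop≡id k α) ⟩
      h α                         ∎
    where open ≡-Reasoning

weight+zeros≡length : ∀ w → weight w + zeros w ≡ length w
weight+zeros≡length []          = refl
weight+zeros≡length (true ∷ w)  = cong suc (weight+zeros≡length w)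
weight+zeros≡length (false ∷ w) = trans (+-suc (weight w) (zeros w)) (cong suc (weight+zeros≡length w))

weight-complement : ∀ w → weight (complement w) ≡ zeros w
weight-complement []          = refl
weight-complement (true ∷ w)  = weight-complement w
weight-complement (false ∷ w) = cong suc (weight-complement w)

zeros-complement : ∀ w → zeros (complement w) ≡ weight w
zeros-complement []          = refl
zeros-complement (true ∷ w)  = cong suc (zeros-complement w)
zeros-complement (false ∷ w) = zeros-complement w

complement-++ : ∀ x y → complement (x ++ y) ≡ complement x ++ complement y
complement-++ x y = map-++ not x y

complement-involutive : ∀ w → complement (complement w) ≡ w
complement-involutive w = trans (sym (map-∘ w)) (trans (map-cong not-involutive w) (map-id w))

rotate-length : ∀ k α → length (rotate k α) ≡ length α
rotate-length = additive-rotate length-additive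

rotate-zero : ∀ α → rotate 0 α ≡ α
rotate-zero = ++-identityʳ

rotate-full : ∀ k α → length α ≤ k → rotate k α ≡ α
rotate-full k α p = cong₂ _++_ (drop-all k α p) (take-all k α p)

rotate-+ : ∀ a b α → a + b ≤ length α → rotate a (rotate b α) ≡ rotate (a + b) α
rotate-+ a b α a+b≤ = begin
    drop a (r ++ x) ++ take a (r ++ x) ≡⟨ cong₂ _++_ (drop-++-≤ a r x a≤r) (take-++-≤ a r x a≤r) ⟩
    (drop a r ++ x) ++ take a r        ≡⟨ ++-assoc (drop a r) x (take a r) ⟩
    drop a r ++ (x ++ take a r)        ≡⟨ cong₂ _++_ (drop-drop b a α) (sym (take-+ b a α)) ⟩
    drop (b + a) α ++ take (b + a) α   ≡⟨ cong (λ z → rotate z α) (+-comm b a) ⟩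
    rotate (a + b) α                   ∎
  where
  open ≡-Reasoning
  x = take b α
  r = drop b α
  a≤r : a ≤ length r
  a≤r = subst (a ≤_) (sym (length-drop b α))
          (subst (_≤ length α ∸ b) (m+n∸n≡m a b) (∸-monoˡ-≤ b a+b≤))

rotate-inverse : ∀ b α → b ≤ length α → rotate (length α ∸ b) (rotate b α) ≡ α
rotate-inverse b α b≤ = begin
    rotate (length α ∸ b) (rotate b α) ≡⟨ rotate-+ (length α ∸ b) b α (≤-reflexive (m∸n+n≡m b≤)) ⟩
    rotate (length α ∸ b + b) α        ≡⟨ cong (λ z → rotate z α) (m∸n+n≡m b≤) ⟩
    rotate (length α) α                ≡⟨ rotate-full (length α) α ≤-refl ⟩
    α                                  ∎
  where open ≡-Reasoning

rotate-compose : ∀ a b α → a ≤ length α → b ≤ length α →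
                 ∃ λ c → c ≤ length α × rotate a (rotate b α) ≡ rotate c α
rotate-compose a b α a≤ b≤ with a + b ≤? length α
... | yes a+b≤ = a + b , a+b≤ , rotate-+ a b α a+b≤
... | no  a+b≰ = c , ≤-trans (m∸n≤m a (n ∸ b)) a≤ , composed
  where
  n = length α
  c = a ∸ (n ∸ b)
  n∸b≤a : n ∸ b ≤ a
  n∸b≤a = subst (n ∸ b ≤_) (m+n∸n≡m a b) (∸-monoˡ-≤ b (<⇒≤ (≰⇒> a+b≰)))
  a≡ : a ≡ c + (n ∸ b)
  a≡ = sym (m∸n+n≡m n∸b≤a)
  composed : rotate a (rotate b α) ≡ rotate c α
  composed = begin
      rotate a (rotate b α)                   ≡⟨ cong (λ z → rotate z (rotate b α)) a≡ ⟩
      rotate (c + (n ∸ b)) (rotate b α)       ≡⟨ sym (rotate-+ c (n ∸ b) (rotate b α) fits) ⟩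
      rotate c (rotate (n ∸ b) (rotate b α))  ≡⟨ cong (rotate c) (rotate-inverse b α b≤) ⟩
      rotate c α                              ∎
    where
    open ≡-Reasoning
    fits : c + (n ∸ b) ≤ length (rotate b α)
    fits = subst₂ _≤_ a≡ (sym (rotate-length b α)) a≤

rotate-multiple : ∀ q k α → k * q ≤ length α → rotate q α ≡ α → rotate (k * q) α ≡ α
rotate-multiple q zero    α _  _   = rotate-zero α
rotate-multiple q (suc k) α le per = begin
    rotate (q + k * q) α       ≡⟨ sym (rotate-+ q (k * q) α le) ⟩
    rotate q (rotate (k * q) α) ≡⟨ cong (rotate q) (rotate-multiple q k α (≤-trans (m≤n+m (k * q) q) le) per) ⟩
    rotate q α                 ≡⟨ per ⟩
    α                          ∎
  where open ≡-Reasoning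

rotate-mod : ∀ p t α .{{_ : NonZero p}} → rotate p α ≡ α → t ≤ length α →
             rotate t α ≡ rotate (t % p) α
rotate-mod p t α per t≤ = begin
    rotate t α                         ≡⟨ cong (λ z → rotate z α) t≡ ⟩
    rotate (t % p + t / p * p) α       ≡⟨ sym (rotate-+ (t % p) (t / p * p) α (subst (_≤ length α) t≡ t≤)) ⟩
    rotate (t % p) (rotate (t / p * p) α) ≡⟨ cong (rotate (t % p)) (rotate-multiple p (t / p) α q≤ per) ⟩
    rotate (t % p) α                   ∎
  where
  open ≡-Reasoning
  t≡ = m≡m%n+[m/n]*n t p
  q≤ : t / p * p ≤ length α
  q≤ = ≤-trans (m≤n+m (t / p * p) (t % p)) (subst (_≤ length α) t≡ t≤)

eqStr-sound : ∀ a b → T (eqStr a b) → a ≡ b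
eqStr-sound []          []          _ = refl
eqStr-sound (true ∷ u)  (true ∷ v)  e = cong (true ∷_) (eqStr-sound u v e)
eqStr-sound (false ∷ u) (false ∷ v) e = cong (false ∷_) (eqStr-sound u v e)

eqStr-refl : ∀ a → T (eqStr a a)
eqStr-refl []          = tt
eqStr-refl (true ∷ u)  = eqStr-refl u
eqStr-refl (false ∷ u) = eqStr-refl u

power-comm : ∀ m b → power m b ++ b ≡ b ++ power m b
power-comm zero    b = sym (++-identityʳ b)
power-comm (suc m) b = trans (++-assoc b (power m b) b) (cong (b ++_) (power-comm m b))

rotate-power : ∀ m b → rotate (length b) (power (suc m) b) ≡ power (suc m) b
rotate-power m b =
  trans (cong₂ _++_ (drop-length-++ b (power m b)) (take-length-++ b (power m b))) (power-comm m b)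

commuting-power : ∀ c (x y : BinStr) → length y ≡ c * length x → x ++ y ≡ y ++ x → y ≡ power c x
commuting-power zero    x [] _ _ = refl
commuting-power (suc c) x y ly comm = trans y≡xy' (cong (x ++_) y'≡)
  where
  open ≡-Reasoning
  y' = drop (length x) y
  x≤y : length x ≤ length y
  x≤y = subst (length x ≤_) (sym ly) (m≤m+n (length x) _)
  x≡ : x ≡ take (length x) y
  x≡ = trans (sym (take-length-++ x y)) (trans (cong (take (length x)) comm) (take-++-≤ (length x) y x x≤y))
  y≡xy' : y ≡ x ++ y'
  y≡xy' = trans (sym (take++drop≡id (length x) y)) (cong (_++ y') (sym x≡))
  ly' : length y' ≡ c * length x
  ly' = trans (length-drop (length x) y) (trans (cong (_∸ length x) ly) (m+n∸m≡n (length x) _))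
  comm' : x ++ (x ++ y') ≡ x ++ (y' ++ x)
  comm' = begin
      x ++ (x ++ y') ≡⟨ cong (x ++_) (sym y≡xy') ⟩
      x ++ y         ≡⟨ comm ⟩
      y ++ x         ≡⟨ cong (_++ x) y≡xy' ⟩
      (x ++ y') ++ x ≡⟨ ++-assoc x y' x ⟩
      x ++ (y' ++ x) ∎
  y'≡ : y' ≡ power c x
  y'≡ = commuting-power c x y' ly' (++-cancelˡ x (x ++ y') (y' ++ x) comm')

period-power : ∀ g q α → length α ≡ suc q * g → rotate g α ≡ α → α ≡ power (suc q) (take g α)
period-power g q α ln per = trans (sym (take++drop≡id g α)) (cong (take g α ++_) drop≡)
  where
  g≤ : g ≤ length α
  g≤ = subst (g ≤_) (sym ln) (m≤m+n g _)
  ldrop : length (drop g α) ≡ q * length (take g α)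
  ldrop = trans (length-drop g α)
            (trans (cong (_∸ g) ln) (trans (m+n∸m≡n g (q * g)) (cong (q *_) (sym (length-take-≤ g α g≤)))))
  drop≡ : drop g α ≡ power q (take g α)
  drop≡ = commuting-power q (take g α) (drop g α) ldrop (trans (take++drop≡id g α) (sym per))

prSearch-root : ∀ α ps → ∃ λ m → α ≡ power (suc m) (prSearch α ps)
prSearch-root α []       = 0 , sym (++-identityʳ α)
prSearch-root α (p ∷ ps) with isPeriodPrefix α p in eq
... | true  = let j , e = satisfied (Any.any⁻ _ (upTo (length α)) (subst T (sym eq) tt))
              in j , sym (eqStr-sound _ _ e)
... | false = prSearch-root α ps

pr-root : ∀ α → ∃ λ m → α ≡ power (suc m) (pr α)
pr-root α = prSearch-root α (upTo (suc (length α)))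

pr-length : ∀ α → ∃ λ m → length α ≡ suc m * length (pr α)
pr-length α = let m , e = pr-root α in m , trans (cong length e) (additive-power length-additive (suc m) (pr α))

pr-length-≤ : ∀ α → length (pr α) ≤ length α
pr-length-≤ α = let m , e = pr-length α in subst (length (pr α) ≤_) (sym e) (m≤m+n (length (pr α)) _)

pr-nonempty : ∀ α → 0 < length α → 0 < length (pr α)
pr-nonempty α 0<n with pr-length α
... | m , e with length (pr α)
...   | zero  = ⊥-elim (<-irrefl (sym (trans e (*-zeroʳ (suc m)))) 0<n)
...   | suc _ = s≤s z≤n

rotate-pr : ∀ α → rotate (length (pr α)) α ≡ α
rotate-pr α = let m , e = pr-root α in
  trans (cong (rotate (length (pr α))) e) (trans (rotate-power m (pr α)) (sym e))

prSearch-min : ∀ α (f : ℕ → ℕ) k j → j < k → T (isPeriodPrefix α (f j)) →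
               (∀ i → i ≤ j → f i ≤ f j) → length (prSearch α (applyUpTo f k)) ≤ f j
prSearch-min α f (suc k) j j<k ip mono with isPeriodPrefix α (f 0) in eq
... | true = ≤-trans (≤-trans (≤-reflexive (length-take (f 0) α)) (m⊓n≤m (f 0) _)) (mono 0 z≤n)
prSearch-min α f (suc k) zero    _         ip _    | false = ⊥-elim (subst T eq ip)
prSearch-min α f (suc k) (suc j) (s≤s j<k) ip mono | false =
  prSearch-min α (λ i → f (suc i)) k j j<k ip (λ i i≤j → mono (suc i) (s≤s i≤j))

pr-≤-divisor : ∀ g q α → 0 < g → length α ≡ suc q * g → rotate g α ≡ α → length (pr α) ≤ g
pr-≤-divisor g q α 0<g ln per = prSearch-min α (λ i → i) (suc (length α)) g (s≤s g≤) isPeriod (λ i i≤ → i≤)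
  where
  g≤ : g ≤ length α
  g≤ = subst (g ≤_) (sym ln) (m≤m+n g _)
  q<n : q < length α
  q<n = subst (q <_) (sym ln) (≤-trans (s≤s (subst (_≤ q * g) (*-identityʳ q) (*-monoʳ-≤ q 0<g)))
                                          (+-monoˡ-≤ (q * g) 0<g))
  isPeriod : T (isPeriodPrefix α g)
  isPeriod = Any.any⁺ _ (lose (∈-upTo⁺ q<n)
               (subst (λ z → T (eqStr z α)) (period-power g q α ln per) (eqStr-refl α)))

-- The periodic reduction is no longer than any positive rotational period:
-- by Euclid's algorithm a period q yields the period |α| mod q.
pr-≤-period : ∀ α q → 0 < q → rotate q α ≡ α → length (pr α) ≤ q
pr-≤-period α = <-rec Goal step
  where
  n = length α
  Goal : ℕ → Set
  Goal q = 0 < q → rotate q α ≡ α → length (pr α) ≤ q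
  step : ∀ q → (∀ {r} → r < q → Goal r) → Goal q
  step q@(suc _) ih _ per with n % q in rem
  ... | zero = divisor-case (n / q) n≡
    where
    n≡ : n ≡ n / q * q
    n≡ = trans (m≡m%n+[m/n]*n n q) (cong (_+ n / q * q) rem)
    divisor-case : ∀ t → n ≡ t * q → length (pr α) ≤ q
    divisor-case zero    n≡0 = ≤-trans (pr-length-≤ α) (subst (_≤ q) (sym n≡0) z≤n)
    divisor-case (suc t) n≡  = pr-≤-divisor q t α (s≤s z≤n) n≡ per
  ... | suc r = ≤-trans (ih r<q (s≤s z≤n) per') (<⇒≤ r<q)
    where
    r<q : suc r < q
    r<q = subst (_< q) rem (m%n<n n q)
    per' : rotate (suc r) α ≡ α
    per' = subst (λ z → rotate z α ≡ α) rem
             (trans (sym (rotate-mod q n α per ≤-refl)) (rotate-full n α ≤-refl))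

lex-refl : ∀ a → T (lexLeq a a)
lex-refl []          = tt
lex-refl (true ∷ a)  = lex-refl a
lex-refl (false ∷ a) = lex-refl a

lex-total : ∀ a b → ¬ T (lexLeq a b) → T (lexLeq b a)
lex-total []          b           a≰b = ⊥-elim (a≰b tt)
lex-total (x ∷ a)     []          _   = tt
lex-total (false ∷ a) (true ∷ b)  a≰b = ⊥-elim (a≰b tt)
lex-total (true ∷ a)  (false ∷ b) _   = tt
lex-total (false ∷ a) (false ∷ b) a≰b = lex-total a b a≰b
lex-total (true ∷ a)  (true ∷ b)  a≰b = lex-total a b a≰b

lex-trans : ∀ a b c → T (lexLeq a b) → T (lexLeq b c) → T (lexLeq a c)
lex-trans []          b           c           _ _ = tt
lex-trans (false ∷ a) (false ∷ b) (false ∷ c) p q = lex-trans a b c p q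
lex-trans (false ∷ a) (false ∷ b) (true ∷ c)  p q = tt
lex-trans (false ∷ a) (true ∷ b)  (true ∷ c)  p q = tt
lex-trans (true ∷ a)  (true ∷ b)  (true ∷ c)  p q = lex-trans a b c p q

lex-antisym : ∀ a b → T (lexLeq a b) → T (lexLeq b a) → a ≡ b
lex-antisym []          []          _ _ = refl
lex-antisym (false ∷ a) (false ∷ b) p q = cong (false ∷_) (lex-antisym a b p q)
lex-antisym (true ∷ a)  (true ∷ b)  p q = cong (true ∷_) (lex-antisym a b p q)

lex-least : ∀ (F : ℕ → BinStr) m → ∃ λ j → j ≤ m × (∀ k → k ≤ m → T (lexLeq (F j) (F k)))
lex-least F zero = 0 , z≤n , λ { zero _ → lex-refl (F 0) }
lex-least F (suc m) with lex-least F m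
... | j , j≤m , least with T? (lexLeq (F j) (F (suc m)))
...   | yes j≤last = j , m≤n⇒m≤1+n j≤m , least'
  where
  least' : ∀ k → k ≤ suc m → T (lexLeq (F j) (F k))
  least' k k≤ with m≤n⇒m<n∨m≡n k≤
  ... | inj₁ k<  = least k (s≤s⁻¹ k<)
  ... | inj₂ refl = j≤last
...   | no j≰last = suc m , ≤-refl , least'
  where
  least' : ∀ k → k ≤ suc m → T (lexLeq (F (suc m)) (F k))
  least' k k≤ with m≤n⇒m<n∨m≡n k≤
  ... | inj₁ k<  = lex-trans (F (suc m)) (F j) (F k) (lex-total (F j) _ j≰last) (least k (s≤s⁻¹ k<))
  ... | inj₂ refl = lex-refl (F (suc m))

necklace-≤-rotation : ∀ α k → T (isNecklace α) → k ≤ length α → T (lexLeq α (rotate k α))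
necklace-≤-rotation α k neck k≤ with m≤n⇒m<n∨m≡n k≤
... | inj₁ k<  = lookup (AllProp.all⁺ (lexLeq α) (rotations α) neck) (∈-map⁺ (λ i → rotate i α) (∈-upTo⁺ k<))
... | inj₂ refl = subst (λ z → T (lexLeq α z)) (sym (rotate-full (length α) α ≤-refl)) (lex-refl α)

necklace-intro : ∀ α → (∀ k → k < length α → T (lexLeq α (rotate k α))) → T (isNecklace α)
necklace-intro α least = AllProp.all⁻ (lexLeq α) (tabulate rotation-bound)
  where
  rotation-bound : ∀ {r} → r ∈ rotations α → T (lexLeq α r)
  rotation-bound r∈ with ∈-map⁻ (λ i → rotate i α) r∈
  ... | i , i∈ , refl = least i (∈-upTo⁻ i∈)

-- Every string has a rotation that is a necklace (its least rotation).
necklace-rotation : ∀ s → ∃ λ j → j ≤ length s × T (isNecklace (rotate j s))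
necklace-rotation s with lex-least (λ k → rotate k s) (length s)
... | j , j≤ , least = j , j≤ , necklace-intro (rotate j s) bound
  where
  bound : ∀ k → k < length (rotate j s) → T (lexLeq (rotate j s) (rotate k (rotate j s)))
  bound k k< with rotate-compose k j s (<⇒≤ (subst (k <_) (rotate-length j s) k<)) j≤
  ... | c , c≤ , e = subst (λ z → T (lexLeq (rotate j s) z)) (sym e) (least c c≤)

necklace-unique : ∀ α β k → T (isNecklace α) → T (isNecklace β) →
                  k ≤ length α → β ≡ rotate k α → α ≡ β
necklace-unique α β k neckα neckβ k≤ β≡ = lex-antisym α β α≤β β≤α
  where
  n = length α
  α≤β : T (lexLeq α β)
  α≤β = subst (λ z → T (lexLeq α z)) (sym β≡) (necklace-≤-rotation α k neckα k≤)
  β≤α : T (lexLeq β α)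
  β≤α = subst (λ z → T (lexLeq β z)) (trans (cong (rotate (n ∸ k)) β≡) (rotate-inverse k α k≤))
          (necklace-≤-rotation β (n ∸ k) neckβ
            (subst (n ∸ k ≤_) (sym (trans (cong length β≡) (rotate-length k α))) (m∸n≤m n k)))

∈-filterᵇ⁻ : ∀ {A : Set} (p : A → Bool) xs {x} → x ∈ filterᵇ p xs → x ∈ xs × T (p x)
∈-filterᵇ⁻ p xs = ∈-filter⁻ (T? ∘ p) {xs = xs}

∈-filterᵇ⁺ : ∀ {A : Set} (p : A → Bool) {x xs} → x ∈ xs → T (p x) → x ∈ filterᵇ p xs
∈-filterᵇ⁺ p = ∈-filter⁺ (T? ∘ p)

∈-allStrings⁻ : ∀ n {s} → s ∈ allStrings n → length s ≡ n
∈-allStrings⁻ zero    (here refl) = refl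
∈-allStrings⁻ (suc n) s∈ with ∈-++⁻ (map (false ∷_) (allStrings n)) s∈
... | inj₁ s∈₀ = let t , t∈ , e = ∈-map⁻ (false ∷_) s∈₀ in trans (cong length e) (cong suc (∈-allStrings⁻ n t∈))
... | inj₂ s∈₁ = let t , t∈ , e = ∈-map⁻ (true ∷_) s∈₁ in trans (cong length e) (cong suc (∈-allStrings⁻ n t∈))

∈-allStrings⁺ : ∀ n s → length s ≡ n → s ∈ allStrings n
∈-allStrings⁺ zero    []          _ = here refl
∈-allStrings⁺ (suc n) (false ∷ s) e = ∈-++⁺ˡ (∈-map⁺ (false ∷_) (∈-allStrings⁺ n s (suc-injective e)))
∈-allStrings⁺ (suc n) (true ∷ s)  e =
  ∈-++⁺ʳ (map (false ∷_) (allStrings n)) (∈-map⁺ (true ∷_) (∈-allStrings⁺ n s (suc-injective e)))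

allStrings-unique : ∀ n → Unique (allStrings n)
allStrings-unique zero    = All.[] AllPairs.∷ AllPairs.[]
allStrings-unique (suc n) = Unique.++⁺ (Unique.map⁺ ∷-injectiveʳ (allStrings-unique n))
                                       (Unique.map⁺ ∷-injectiveʳ (allStrings-unique n)) disjoint
  where
  disjoint : Disjoint (map (false ∷_) (allStrings n)) (map (true ∷_) (allStrings n))
  disjoint (s∈₀ , s∈₁) with ∈-map⁻ (false ∷_) s∈₀ | ∈-map⁻ (true ∷_) s∈₁
  ... | _ , _ , refl | _ , _ , ()

concatMap-unique : ∀ {A B : Set} (f : A → List B) xs → Unique xs → (∀ {x} → x ∈ xs → Unique (f x)) →
                   (∀ {x x' y} → x ∈ xs → x' ∈ xs → y ∈ f x → y ∈ f x' → x ≡ x') →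
                   Unique (concatMap f xs)
concatMap-unique f []       _                  _       _      = AllPairs.[]
concatMap-unique f (x ∷ xs) (x∉ AllPairs.∷ u) uniqueF shared =
  Unique.++⁺ (uniqueF (here refl))
             (concatMap-unique f xs u (uniqueF ∘ there) (λ m m' → shared (there m) (there m')))
             disjoint
  where
  disjoint : Disjoint (f x) (concatMap f xs)
  disjoint (y∈fx , y∈rest) with find (∈-concatMap⁻ f y∈rest)
  ... | x' , x'∈ , y∈fx' = lookup x∉ x'∈ (shared (here refl) (there x'∈) y∈fx y∈fx')

-- The rotation class of α: its |pr α| distinct rotations.
rotationClass : BinStr → List BinStr
rotationClass α = map (λ i → rotate i α) (upTo (length (pr α)))

isHeavy : ℕ → BinStr → Bool
isHeavy d s = d ≤ᵇ weight s

isHeavyNecklace : ℕ → BinStr → Bool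
isHeavyNecklace d α = isNecklace α ∧ isHeavy d α

Necklaces : ℕ → ℕ → List BinStr
Necklaces d n = filterᵇ (isHeavyNecklace d) (allStrings n)

Heavy : ℕ → ℕ → List BinStr
Heavy d n = filterᵇ (isHeavy d) (allStrings n)

necklace-length : ∀ d n {α} → α ∈ Necklaces d n → length α ≡ n
necklace-length d n α∈ = ∈-allStrings⁻ n (proj₁ (∈-filterᵇ⁻ (isHeavyNecklace d) (allStrings n) α∈))

necklace-isNecklace : ∀ d n {α} → α ∈ Necklaces d n → T (isNecklace α)
necklace-isNecklace d n α∈ = proj₁ (to T-∧ (proj₂ (∈-filterᵇ⁻ (isHeavyNecklace d) (allStrings n) α∈)))

necklace-weight : ∀ d n {α} → α ∈ Necklaces d n → d ≤ weight α
necklace-weight d n {α} α∈ = ≤ᵇ⇒≤ d (weight α) (proj₂ (to T-∧ (proj₂ (∈-filterᵇ⁻ (isHeavyNecklace d) (allStrings n) α∈))))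

∈-rotationClass⁻ : ∀ α {s} → s ∈ rotationClass α → ∃ λ i → i < length (pr α) × s ≡ rotate i α
∈-rotationClass⁻ α s∈ = let i , i∈ , e = ∈-map⁻ (λ i → rotate i α) s∈ in i , ∈-upTo⁻ i∈ , e

∈-rotationClass⁺ : ∀ α t → 0 < length α → t ≤ length α → rotate t α ∈ rotationClass α
∈-rotationClass⁺ α t 0<n t≤ with length (pr α) | rotate-pr α | pr-nonempty α 0<n
... | p@(suc _) | per | _ = subst (_∈ map (λ i → rotate i α) (upTo p)) (sym (rotate-mod p t α per t≤))
                             (∈-map⁺ (λ i → rotate i α) (∈-upTo⁺ (m%n<n t p)))

-- The members of a rotation class are pairwise distinct: two equal rotations
-- i < j would give the rotational period j − i < |pr α|.
rotationClass-distinct : ∀ α i j → 0 < length α → i < j → j < length (pr α) → rotate i α ≢ rotate j α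
rotationClass-distinct α i j 0<n i<j j<p ri≡rj =
  <-irrefl refl (≤-<-trans (pr-≤-period α (j ∸ i) (m<n⇒0<n∸m i<j) period) (≤-<-trans (m∸n≤m j i) j<p))
  where
  open ≡-Reasoning
  n = length α
  j≤n : j ≤ n
  j≤n = ≤-trans (<⇒≤ j<p) (pr-length-≤ α)
  r = (n ∸ j) + i
  j∸i+r : (j ∸ i) + r ≡ n
  j∸i+r = begin
      (j ∸ i) + ((n ∸ j) + i) ≡⟨ cong ((j ∸ i) +_) (+-comm (n ∸ j) i) ⟩
      (j ∸ i) + (i + (n ∸ j)) ≡⟨ sym (+-assoc (j ∸ i) i (n ∸ j)) ⟩
      ((j ∸ i) + i) + (n ∸ j) ≡⟨ cong (_+ (n ∸ j)) (m∸n+n≡m (<⇒≤ i<j)) ⟩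
      j + (n ∸ j)             ≡⟨ m+[n∸m]≡n j≤n ⟩
      n                       ∎
  α≡ : α ≡ rotate r α
  α≡ = begin
      α                               ≡⟨ sym (rotate-inverse j α j≤n) ⟩
      rotate (n ∸ j) (rotate j α)     ≡⟨ cong (rotate (n ∸ j)) (sym ri≡rj) ⟩
      rotate (n ∸ j) (rotate i α)     ≡⟨ rotate-+ (n ∸ j) i α (subst (r ≤_) j∸i+r (m≤n+m r (j ∸ i))) ⟩
      rotate r α                      ∎
  period : rotate (j ∸ i) α ≡ α
  period = begin
      rotate (j ∸ i) α                ≡⟨ cong (rotate (j ∸ i)) α≡ ⟩
      rotate (j ∸ i) (rotate r α)     ≡⟨ rotate-+ (j ∸ i) r α (≤-reflexive j∸i+r) ⟩
      rotate ((j ∸ i) + r) α          ≡⟨ cong (λ z → rotate z α) j∸i+r ⟩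
      rotate n α                      ≡⟨ rotate-full n α ≤-refl ⟩
      α                               ∎

rotationClass-unique : ∀ α → 0 < length α → Unique (rotationClass α)
rotationClass-unique α 0<n = subst Unique (sym (map-upTo (λ i → rotate i α) (length (pr α))))
  (Unique.applyUpTo⁺₁ (λ i → rotate i α) (length (pr α)) (λ i<j j<p → rotationClass-distinct α _ _ 0<n i<j j<p))

module _ (d n : ℕ) (0<n : 0 < n) where

  private
    Classes = concatMap rotationClass (Necklaces d n)

  classes⊆heavy : ∀ {s} → s ∈ Classes → s ∈ Heavy d n
  classes⊆heavy s∈ with find (∈-concatMap⁻ rotationClass {xs = Necklaces d n} s∈)
  ... | α , α∈ , s∈α with ∈-rotationClass⁻ α s∈α
  ...   | i , _ , refl =
    ∈-filterᵇ⁺ (isHeavy d) (∈-allStrings⁺ n _ (trans (rotate-length i α) (necklace-length d n α∈)))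
      (≤⇒≤ᵇ (subst (d ≤_) (sym (additive-rotate weight-additive i α)) (necklace-weight d n α∈)))

  heavy⊆classes : ∀ {s} → s ∈ Heavy d n → s ∈ Classes
  heavy⊆classes {s} s∈ with ∈-filterᵇ⁻ (isHeavy d) (allStrings n) s∈ | necklace-rotation s
  ... | s∈all , heavy | j , j≤ , neck = ∈-concatMap⁺ rotationClass {xs = Necklaces d n} (lose α∈ s∈α)
    where
    α = rotate j s
    lα : length α ≡ n
    lα = trans (rotate-length j s) (∈-allStrings⁻ n s∈all)
    α∈ : α ∈ Necklaces d n
    α∈ = ∈-filterᵇ⁺ (isHeavyNecklace d) (∈-allStrings⁺ n α lα)
           (from T-∧ (neck , subst (λ w → T (d ≤ᵇ w)) (sym (additive-rotate weight-additive j s)) heavy))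
    s∈α : s ∈ rotationClass α
    s∈α = subst (_∈ rotationClass α) (rotate-inverse j s j≤)
            (∈-rotationClass⁺ α (length s ∸ j) (subst (0 <_) (sym lα) 0<n)
              (subst (length s ∸ j ≤_) (sym (rotate-length j s)) (m∸n≤m (length s) j)))

  classes-unique : Unique Classes
  classes-unique = concatMap-unique rotationClass (Necklaces d n)
    (Unique.filter⁺ (T? ∘ isHeavyNecklace d) (allStrings-unique n))
    (λ α∈ → rotationClass-unique _ (subst (0 <_) (sym (necklace-length d n α∈)) 0<n))
    same-necklace
    where
    same-necklace : ∀ {α β s} → α ∈ Necklaces d n → β ∈ Necklaces d n →
                    s ∈ rotationClass α → s ∈ rotationClass β → α ≡ β
    same-necklace {α} {β} α∈ β∈ s∈α s∈β with ∈-rotationClass⁻ α s∈α | ∈-rotationClass⁻ β s∈β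
    ... | i , i< , refl | i' , i'< , s≡ =
      necklace-unique α β c (necklace-isNecklace d n α∈) (necklace-isNecklace d n β∈) c≤ β≡
      where
      i≤ : i ≤ length α
      i≤ = ≤-trans (<⇒≤ i<) (pr-length-≤ α)
      i'≤ : i' ≤ length β
      i'≤ = ≤-trans (<⇒≤ i'<) (pr-length-≤ β)
      back≤ : length β ∸ i' ≤ length α
      back≤ = subst (length β ∸ i' ≤_) (trans (necklace-length d n β∈) (sym (necklace-length d n α∈)))
                (m∸n≤m (length β) i')
      composed = rotate-compose (length β ∸ i') i α back≤ i≤
      c = proj₁ composed
      c≤ = proj₁ (proj₂ composed)
      β≡ : β ≡ rotate c α
      β≡ = trans (sym (rotate-inverse i' β i'≤))
             (trans (cong (rotate (length β ∸ i')) (sym s≡)) (proj₂ (proj₂ composed)))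

  necklace-enumeration : Classes ↭ Heavy d n
  necklace-enumeration = ∼bag⇒↭ (unique∧set⇒bag classes-unique
    (Unique.filter⁺ (T? ∘ isHeavy d) (allStrings-unique n)) (mk⇔ classes⊆heavy heavy⊆classes))

sum-map-concatMap : ∀ (h : BinStr → ℕ) (f : BinStr → List BinStr) xs →
                    sum (map h (concatMap f xs)) ≡ sum (map (λ x → sum (map h (f x))) xs)
sum-map-concatMap h f []       = refl
sum-map-concatMap h f (x ∷ xs) = begin
    sum (map h (f x ++ concatMap f xs))             ≡⟨ cong sum (map-++ h (f x) (concatMap f xs)) ⟩
    sum (map h (f x) ++ map h (concatMap f xs))     ≡⟨ sum-++ (map h (f x)) _ ⟩
    sum (map h (f x)) + sum (map h (concatMap f xs)) ≡⟨ cong (sum (map h (f x)) +_) (sum-map-concatMap h f xs) ⟩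
    sum (map h (f x)) + sum (map (λ x → sum (map h (f x))) xs) ∎
  where open ≡-Reasoning

sum-map-* : ∀ n (g : BinStr → ℕ) xs → n * sum (map g xs) ≡ sum (map (λ x → n * g x) xs)
sum-map-* n g []       = *-zeroʳ n
sum-map-* n g (x ∷ xs) = trans (*-distribˡ-+ n (g x) _) (cong (n * g x +_) (sum-map-* n g xs))

module _ {h : BinStr → ℕ} (add : Additive h) where

  -- Since α = (pr α)^(|α|/|pr α|), h scales like the length.
  pr-scale : ∀ α → length α * h (pr α) ≡ length (pr α) * h α
  pr-scale α with pr-root α
  ... | m , α≡ = begin
      length α * h (pr α)                        ≡⟨ cong (λ z → length z * h (pr α)) α≡ ⟩
      length (power (suc m) (pr α)) * h (pr α)   ≡⟨ cong (_* h (pr α)) (additive-power length-additive (suc m) (pr α)) ⟩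
      (suc m * length (pr α)) * h (pr α)         ≡⟨ cong (_* h (pr α)) (*-comm (suc m) (length (pr α))) ⟩
      (length (pr α) * suc m) * h (pr α)         ≡⟨ *-assoc (length (pr α)) (suc m) (h (pr α)) ⟩
      length (pr α) * (suc m * h (pr α))         ≡⟨ cong (length (pr α) *_) (sym (additive-power add (suc m) (pr α))) ⟩
      length (pr α) * h (power (suc m) (pr α))   ≡⟨ cong (λ z → length (pr α) * h z) (sym α≡) ⟩
      length (pr α) * h α                        ∎
    where open ≡-Reasoning

  rotationClass-sum : ∀ α → sum (map h (rotationClass α)) ≡ length (pr α) * h α
  rotationClass-sum α = trans (go (upTo (length (pr α)))) (cong (_* h α) (length-upTo (length (pr α))))
    where
    go : ∀ is → sum (map h (map (λ i → rotate i α) is)) ≡ length is * h α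
    go []       = refl
    go (i ∷ is) = cong₂ _+_ (additive-rotate add i α) (go is)

  D-count : ∀ d n → 0 < n → n * h (D d n) ≡ sum (map h (Heavy d n))
  D-count d n 0<n = begin
      n * h (concat (map pr N))                           ≡⟨ cong (n *_) (additive-concat add (map pr N)) ⟩
      n * sum (map h (map pr N))                          ≡⟨ cong (λ z → n * sum z) (sym (map-∘ N)) ⟩
      n * sum (map (λ α → h (pr α)) N)                    ≡⟨ sum-map-* n (λ α → h (pr α)) N ⟩
      sum (map (λ α → n * h (pr α)) N)                    ≡⟨ cong sum (map-cong-local (tabulate scale)) ⟩
      sum (map (λ α → sum (map h (rotationClass α))) N)   ≡⟨ sym (sum-map-concatMap h rotationClass N) ⟩
      sum (map h (concatMap rotationClass N))             ≡⟨ sum-↭ (Perm.map⁺ h (necklace-enumeration d n 0<n)) ⟩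
      sum (map h (Heavy d n))                             ∎
    where
    open ≡-Reasoning
    N = Necklaces d n
    scale : ∀ {α} → α ∈ N → n * h (pr α) ≡ sum (map h (rotationClass α))
    scale {α} α∈ = trans (cong (_* h (pr α)) (sym (necklace-length d n α∈)))
                     (trans (pr-scale α) (sym (rotationClass-sum α)))

filterᵇ-map : ∀ (p q : BinStr → Bool) (f : BinStr → BinStr) → (∀ x → p (f x) ≡ q x) →
              ∀ xs → filterᵇ p (map f xs) ≡ map f (filterᵇ q xs)
filterᵇ-map p q f pf≡q []       = refl
filterᵇ-map p q f pf≡q (x ∷ xs) with p (f x) | q x | pf≡q x
... | true  | true  | _ = cong (f x ∷_) (filterᵇ-map p q f pf≡q xs)
... | false | false | _ = filterᵇ-map p q f pf≡q xs

heavySum : (BinStr → ℕ) → ℕ → ℕ → ℕ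
heavySum h n d = sum (map h (Heavy d n))

-- A heavy string of length n + 1 is 0 followed by a string of weight ≥ d,
-- or 1 followed by a string of weight ≥ d − 1.
heavySum-step : ∀ h n d → heavySum h (suc n) d ≡ heavySum (h ∘ (false ∷_)) n d + heavySum (h ∘ (true ∷_)) n (d ∸ 1)
heavySum-step h n d = begin
    sum (map h (filterᵇ (isHeavy d) (map (false ∷_) A ++ map (true ∷_) A)))
  ≡⟨ cong (sum ∘ map h) (filter-++ (T? ∘ isHeavy d) (map (false ∷_) A) (map (true ∷_) A)) ⟩
    sum (map h (filterᵇ (isHeavy d) (map (false ∷_) A) ++ filterᵇ (isHeavy d) (map (true ∷_) A)))
  ≡⟨ cong (sum ∘ map h) (cong₂ _++_ (filterᵇ-map _ _ (false ∷_) (λ _ → refl) A)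
                                     (filterᵇ-map _ _ (true ∷_) (λ x → ≤ᵇ-suc d (weight x)) A)) ⟩
    sum (map h (map (false ∷_) (Heavy d n) ++ map (true ∷_) (Heavy (d ∸ 1) n)))
  ≡⟨ cong sum (map-++ h (map (false ∷_) (Heavy d n)) _) ⟩
    sum (map h (map (false ∷_) (Heavy d n)) ++ map h (map (true ∷_) (Heavy (d ∸ 1) n)))
  ≡⟨ sum-++ (map h (map (false ∷_) (Heavy d n))) _ ⟩
    sum (map h (map (false ∷_) (Heavy d n))) + sum (map h (map (true ∷_) (Heavy (d ∸ 1) n)))
  ≡⟨ cong₂ _+_ (cong sum (sym (map-∘ (Heavy d n)))) (cong sum (sym (map-∘ (Heavy (d ∸ 1) n)))) ⟩
    heavySum (h ∘ (false ∷_)) n d + heavySum (h ∘ (true ∷_)) n (d ∸ 1)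
  ∎
  where
  open ≡-Reasoning
  A = allStrings n
  ≤ᵇ-suc : ∀ d w → (d ≤ᵇ suc w) ≡ ((d ∸ 1) ≤ᵇ w)
  ≤ᵇ-suc zero          w = refl
  ≤ᵇ-suc (suc zero)    w = refl
  ≤ᵇ-suc (suc (suc _)) w = refl

heavySum-suc : ∀ g n d → heavySum (suc ∘ g) n d ≡ heavySum (λ _ → 1) n d + heavySum g n d
heavySum-suc g n d = go (Heavy d n)
  where
  go : ∀ xs → sum (map (suc ∘ g) xs) ≡ sum (map (λ _ → 1) xs) + sum (map g xs)
  go []       = refl
  go (x ∷ xs) = cong suc (trans (cong (g x +_) (go xs)) (x+[y+z]≡y+[x+z] (g x) (sum (map (λ _ → 1) xs)) (sum (map g xs))))
    where
    x+[y+z]≡y+[x+z] : ∀ a b c → a + (b + c) ≡ b + (a + c)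
    x+[y+z]≡y+[x+z] = solve-∀

heavyCount heavyWeight heavyZeros : ℕ → ℕ → ℕ
heavyCount  = heavySum (λ _ → 1)
heavyWeight = heavySum weight
heavyZeros  = heavySum zeros

heavyCount-step : ∀ n d → heavyCount (suc n) d ≡ heavyCount n d + heavyCount n (d ∸ 1)
heavyCount-step n d = heavySum-step (λ _ → 1) n d

heavyWeight-step : ∀ n d → heavyWeight (suc n) d ≡ heavyWeight n d + (heavyCount n (d ∸ 1) + heavyWeight n (d ∸ 1))
heavyWeight-step n d = trans (heavySum-step weight n d) (cong (heavyWeight n d +_) (heavySum-suc weight n (d ∸ 1)))

heavyZeros-step : ∀ n d → heavyZeros (suc n) d ≡ (heavyCount n d + heavyZeros n d) + heavyZeros n (d ∸ 1)
heavyZeros-step n d = trans (heavySum-step zeros n d) (cong (_+ heavyZeros n (d ∸ 1)) (heavySum-suc zeros n d))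

nC0≡1 : ∀ n → n C 0 ≡ 1
nC0≡1 n = trans (nCk≡nC[n∸k] {0} {n} z≤n) (nCn≡1 n)

-- The strings of weight exactly e number n C e.
heavyCount-binomial : ∀ n e → heavyCount n e ≡ heavyCount n (suc e) + n C e
heavyCount-binomial zero    zero    = refl
heavyCount-binomial zero    (suc e) = sym (k>n⇒nCk≡0 {0} {suc e} (s≤s z≤n))
heavyCount-binomial (suc n) zero    = begin
    heavyCount (suc n) 0                    ≡⟨ heavyCount-step n 0 ⟩
    heavyCount n 0 + heavyCount n 0         ≡⟨ cong (heavyCount n 0 +_) (trans (heavyCount-binomial n 0) (cong (heavyCount n 1 +_) (nC0≡1 n))) ⟩
    heavyCount n 0 + (heavyCount n 1 + 1)   ≡⟨ rearrange (heavyCount n 0) (heavyCount n 1) ⟩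
    (heavyCount n 1 + heavyCount n 0) + 1   ≡⟨ cong₂ _+_ (sym (heavyCount-step n 1)) (sym (nC0≡1 (suc n))) ⟩
    heavyCount (suc n) 1 + suc n C 0        ∎
  where
  open ≡-Reasoning
  rearrange : ∀ a b → a + (b + 1) ≡ (b + a) + 1
  rearrange = solve-∀
heavyCount-binomial (suc n) (suc e) = begin
    heavyCount (suc n) (suc e)
  ≡⟨ heavyCount-step n (suc e) ⟩
    heavyCount n (suc e) + heavyCount n e
  ≡⟨ cong₂ _+_ (heavyCount-binomial n (suc e)) (heavyCount-binomial n e) ⟩
    (heavyCount n (2+ e) + n C suc e) + (heavyCount n (suc e) + n C e)
  ≡⟨ rearrange (heavyCount n (2+ e)) (n C suc e) (heavyCount n (suc e)) (n C e) ⟩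
    (heavyCount n (2+ e) + heavyCount n (suc e)) + (n C e + n C suc e)
  ≡⟨ cong₂ _+_ (sym (heavyCount-step n (2+ e))) (nCk+nC[k+1]≡[n+1]C[k+1] n e) ⟩
    heavyCount (suc n) (2+ e) + suc n C suc e
  ∎
  where
  open ≡-Reasoning
  rearrange : ∀ a b c d → (a + b) + (c + d) ≡ (a + c) + (d + b)
  rearrange = solve-∀

heavyWeight≡heavyZeros-0 : ∀ n → heavyWeight n 0 ≡ heavyZeros n 0
heavyWeight≡heavyZeros-0 zero    = refl
heavyWeight≡heavyZeros-0 (suc n) = begin
    heavyWeight (suc n) 0                                   ≡⟨ heavyWeight-step n 0 ⟩
    heavyWeight n 0 + (heavyCount n 0 + heavyWeight n 0)    ≡⟨ cong₂ (λ a b → a + (heavyCount n 0 + b)) ih ih ⟩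
    heavyZeros n 0 + (heavyCount n 0 + heavyZeros n 0)      ≡⟨ rearrange (heavyZeros n 0) (heavyCount n 0) ⟩
    (heavyCount n 0 + heavyZeros n 0) + heavyZeros n 0      ≡⟨ sym (heavyZeros-step n 0) ⟩
    heavyZeros (suc n) 0                                    ∎
  where
  open ≡-Reasoning
  ih = heavyWeight≡heavyZeros-0 n
  rearrange : ∀ a b → a + (b + a) ≡ (b + a) + a
  rearrange = solve-∀

-- Over the strings of weight ≥ e + 1, ones exceed zeros by n · C(n−1, e):
-- Σ_{w>e} C(n,w)(2w − n) telescopes, proved here via the first-letter recurrences.
heavy-excess : ∀ n e → heavyWeight n (suc e) ≡ heavyZeros n (suc e) + n * ((n ∸ 1) C e)
heavy-excess zero    e    = refl
heavy-excess (suc n) zero = begin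
    heavyWeight (suc n) 1
  ≡⟨ heavyWeight-step n 1 ⟩
    heavyWeight n 1 + (heavyCount n 0 + heavyWeight n 0)
  ≡⟨ cong₂ _+_ (heavy-excess n 0) (cong₂ _+_ count0 (heavyWeight≡heavyZeros-0 n)) ⟩
    (heavyZeros n 1 + n * ((n ∸ 1) C 0)) + ((heavyCount n 1 + 1) + heavyZeros n 0)
  ≡⟨ cong (λ z → (heavyZeros n 1 + n * z) + ((heavyCount n 1 + 1) + heavyZeros n 0)) (nC0≡1 (n ∸ 1)) ⟩
    (heavyZeros n 1 + n * 1) + ((heavyCount n 1 + 1) + heavyZeros n 0)
  ≡⟨ rearrange (heavyZeros n 1) n (heavyCount n 1) (heavyZeros n 0) ⟩
    ((heavyCount n 1 + heavyZeros n 1) + heavyZeros n 0) + suc n * 1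
  ≡⟨ cong₂ _+_ (sym (heavyZeros-step n 1)) (cong (suc n *_) (sym (nC0≡1 n))) ⟩
    heavyZeros (suc n) 1 + suc n * (n C 0)
  ∎
  where
  open ≡-Reasoning
  count0 : heavyCount n 0 ≡ heavyCount n 1 + 1
  count0 = trans (heavyCount-binomial n 0) (cong (heavyCount n 1 +_) (nC0≡1 n))
  rearrange : ∀ g n' a b → (g + n' * 1) + ((a + 1) + b) ≡ ((a + g) + b) + suc n' * 1
  rearrange = solve-∀
heavy-excess (suc n) (suc e) = begin
    heavyWeight (suc n) (2+ e)
  ≡⟨ heavyWeight-step n (2+ e) ⟩
    heavyWeight n (2+ e) + (heavyCount n (suc e) + heavyWeight n (suc e))
  ≡⟨ cong₂ _+_ (heavy-excess n (suc e)) (cong₂ _+_ (heavyCount-binomial n (suc e)) (heavy-excess n e)) ⟩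
    (Z₂ + n * ((n ∸ 1) C suc e)) + ((heavyCount n (2+ e) + n C suc e) + (Z₁ + n * ((n ∸ 1) C e)))
  ≡⟨ rearrange Z₂ n ((n ∸ 1) C suc e) (heavyCount n (2+ e)) (n C suc e) Z₁ ((n ∸ 1) C e) ⟩
    ((heavyCount n (2+ e) + Z₂) + Z₁) + (n C suc e + n * ((n ∸ 1) C suc e + (n ∸ 1) C e))
  ≡⟨ cong₂ _+_ (sym (heavyZeros-step n (2+ e))) (cong (n C suc e +_) (pascal n e)) ⟩
    heavyZeros (suc n) (2+ e) + (n C suc e + n * (n C suc e))
  ∎
  where
  open ≡-Reasoning
  Z₁ = heavyZeros n (suc e)
  Z₂ = heavyZeros n (2+ e)
  pascal : ∀ n e → n * ((n ∸ 1) C suc e + (n ∸ 1) C e) ≡ n * (n C suc e)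
  pascal zero    e = refl
  pascal (suc m) e = cong (suc m *_) (trans (+-comm (m C suc e) (m C e)) (nCk+nC[k+1]≡[n+1]C[k+1] m e))
  rearrange : ∀ g₂ n' c₁ a c g₁ c₀ → (g₂ + n' * c₁) + ((a + c) + (g₁ + n' * c₀)) ≡ ((a + g₂) + g₁) + (c + n' * (c₁ + c₀))
  rearrange = solve-∀

D-excess : ∀ n e → weight (D (suc e) (suc n)) ≡ zeros (D (suc e) (suc n)) + n C e
D-excess n e = *-cancelˡ-≡ _ _ (suc n) (begin
    suc n * weight Dₑ                      ≡⟨ D-count weight-additive (suc e) (suc n) (s≤s z≤n) ⟩
    heavyWeight (suc n) (suc e)            ≡⟨ heavy-excess (suc n) e ⟩
    heavyZeros (suc n) (suc e) + suc n * (n C e)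
                                           ≡⟨ cong (_+ suc n * (n C e)) (sym (D-count zeros-additive (suc e) (suc n) (s≤s z≤n))) ⟩
    suc n * zeros Dₑ + suc n * (n C e)     ≡⟨ sym (*-distribˡ-+ (suc n) (zeros Dₑ) (n C e)) ⟩
    suc n * (zeros Dₑ + n C e)             ∎)
  where
  open ≡-Reasoning
  Dₑ = D (suc e) (suc n)

-- Prefix bounds.  OnesBounded H w: in every prefix of w the ones exceed the
-- zeros by at most H.  A bound on the zeros is a bound on the ones of the complement.
OnesBounded : ℕ → BinStr → Set
OnesBounded H w = ∀ k → weight (take k w) ≤ zeros (take k w) + H

short-excess : ∀ n w → length w ≤ n → weight w ≤ zeros w + n
short-excess n w lw = ≤-trans (m≤m+n (weight w) (zeros w))
  (≤-trans (≤-reflexive (weight+zeros≡length w)) (≤-trans lw (m≤n+m n (zeros w))))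

short-bounded : ∀ n w → length w ≤ n → OnesBounded n w
short-bounded n w lw k = short-excess n (take k w) (≤-trans (≤-reflexive (length-take k w)) (≤-trans (m⊓n≤n k _) lw))

ones-bounded-take : ∀ {H} j w → OnesBounded H w → OnesBounded H (take j w)
ones-bounded-take j w bnd k rewrite take-take k j w = bnd (k ⊓ j)

-- Concatenation: the prefixes of x y reaching into y carry the excess of x
-- on top of the excess of a prefix of y.
ones-bounded-++ : ∀ {H₁ H₂ H} x y → OnesBounded H₁ x → OnesBounded H₂ y → H₁ ≤ H →
                  weight x + H₂ ≤ zeros x + H → OnesBounded H (x ++ y)
ones-bounded-++ {H₁} {H₂} {H} x y bx by H₁≤ joint k with ≤-total k (length x)
... | inj₁ k≤ rewrite take-++-≤ k x y k≤ = ≤-trans (bx k) (+-monoʳ-≤ _ H₁≤)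
... | inj₂ x≤ rewrite take-++ k x y | take-all k x x≤
                    | Additive.h-++ weight-additive x (take (k ∸ length x) y)
                    | Additive.h-++ zeros-additive x (take (k ∸ length x) y) = begin
    weight x + weight v        ≤⟨ +-monoʳ-≤ (weight x) (by (k ∸ length x)) ⟩
    weight x + (zeros v + H₂)  ≡⟨ rearrange (weight x) (zeros v) H₂ ⟩
    zeros v + (weight x + H₂)  ≤⟨ +-monoʳ-≤ (zeros v) joint ⟩
    zeros v + (zeros x + H)    ≡⟨ rearrange' (zeros v) (zeros x) H ⟩
    zeros x + zeros v + H      ∎
  where
  open ≤-Reasoning
  v = take (k ∸ length x) y
  rearrange : ∀ a b c → a + (b + c) ≡ b + (a + c)
  rearrange = solve-∀
  rearrange' : ∀ a b c → a + (b + c) ≡ b + a + c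
  rearrange' = solve-∀

-- The excess of ones over zeros (truncated at 0).
excess : BinStr → ℕ
excess w = weight w ∸ zeros w

nonpositive-blocks-bounded : ∀ n bs → All (λ b → weight b ≤ zeros b × length b ≤ n) bs → OnesBounded n (concat bs)
nonpositive-blocks-bounded n []       []                 zero    = z≤n
nonpositive-blocks-bounded n []       []                 (suc k) = z≤n
nonpositive-blocks-bounded n (b ∷ bs) ((w≤z , lb) ∷ bnds) =
  ones-bounded-++ b (concat bs) (short-bounded n b lb) (nonpositive-blocks-bounded n bs bnds) ≤-refl (+-monoˡ-≤ n w≤z)

concat-nonnegative : ∀ {n} bs → All (λ b → zeros b ≤ weight b × length b ≤ n) bs → zeros (concat bs) ≤ weight (concat bs)
concat-nonnegative []       []                = z≤n
concat-nonnegative (b ∷ bs) ((z≤w , _) ∷ bnds) =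
  subst₂ _≤_ (sym (Additive.h-++ zeros-additive b (concat bs))) (sym (Additive.h-++ weight-additive b (concat bs)))
    (+-mono-≤ z≤w (concat-nonnegative bs bnds))

-- Blocks of length ≤ n with at least as many ones as zeros: a prefix exceeds by
-- at most the total excess plus the partial last block.
nonnegative-blocks-bounded : ∀ n bs → All (λ b → zeros b ≤ weight b × length b ≤ n) bs →
                             OnesBounded (excess (concat bs) + n) (concat bs)
nonnegative-blocks-bounded n []       []                 zero    = z≤n
nonnegative-blocks-bounded n []       []                 (suc k) = z≤n
nonnegative-blocks-bounded n (b ∷ bs) ((z≤w , lb) ∷ bnds) =
  ones-bounded-++ b R (short-bounded n b lb) (nonnegative-blocks-bounded n bs bnds) (m≤n+m n _) (≤-reflexive joint)
  where
  open ≡-Reasoning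
  R = concat bs
  wb : weight b ≡ zeros b + excess b
  wb = sym (m+[n∸m]≡n z≤w)
  wR : weight R ≡ zeros R + excess R
  wR = sym (m+[n∸m]≡n (concat-nonnegative bs bnds))
  excess-++ : excess (b ++ R) ≡ excess b + excess R
  excess-++ = begin
      weight (b ++ R) ∸ zeros (b ++ R)
    ≡⟨ cong₂ _∸_ (trans (Additive.h-++ weight-additive b R) (cong₂ _+_ wb wR)) (Additive.h-++ zeros-additive b R) ⟩
      ((zeros b + excess b) + (zeros R + excess R)) ∸ (zeros b + zeros R)
    ≡⟨ cong (_∸ (zeros b + zeros R)) (rearrange (zeros b) (excess b) (zeros R) (excess R)) ⟩
      ((zeros b + zeros R) + (excess b + excess R)) ∸ (zeros b + zeros R)
    ≡⟨ m+n∸m≡n (zeros b + zeros R) (excess b + excess R) ⟩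
      excess b + excess R
    ∎
    where
    rearrange : ∀ a b c d → (a + b) + (c + d) ≡ (a + c) + (b + d)
    rearrange = solve-∀
  joint : weight b + (excess R + n) ≡ zeros b + (excess (b ++ R) + n)
  joint = begin
      weight b + (excess R + n)                ≡⟨ cong (_+ (excess R + n)) wb ⟩
      zeros b + excess b + (excess R + n)      ≡⟨ rearrange (zeros b) (excess b) (excess R) n ⟩
      zeros b + (excess b + excess R + n)      ≡⟨ cong (λ z → zeros b + (z + n)) (sym excess-++) ⟩
      zeros b + (excess (b ++ R) + n)          ∎
    where
    rearrange : ∀ a b c d → (a + b) + (c + d) ≡ a + ((b + c) + d)
    rearrange = solve-∀

-- The blocks of D_d(n) for n ≤ 2d: every necklace has weight ≥ d ≥ n/2, and its
-- periodic reduction has the same proportion of ones.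
pr-block : ∀ d n {α} → 0 < n → n ≤ d + d → α ∈ Necklaces d n →
           zeros (pr α) ≤ weight (pr α) × length (pr α) ≤ n
pr-block d n {α} 0<n n≤2d α∈ = *-cancelˡ-≤ n {{>-nonZero 0<n}} scaled , subst (length (pr α) ≤_) lα (pr-length-≤ α)
  where
  open ≤-Reasoning
  lα = necklace-length d n α∈
  d≤w = necklace-weight d n α∈
  z≤w : zeros α ≤ weight α
  z≤w = +-cancelˡ-≤ (weight α) _ _ (begin
      weight α + zeros α  ≡⟨ trans (weight+zeros≡length α) lα ⟩
      n                   ≤⟨ n≤2d ⟩
      d + d               ≤⟨ +-mono-≤ d≤w d≤w ⟩
      weight α + weight α ∎)
  scaled : n * zeros (pr α) ≤ n * weight (pr α)
  scaled = begin
      n * zeros (pr α)            ≡⟨ cong (_* zeros (pr α)) (sym lα) ⟩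
      length α * zeros (pr α)     ≡⟨ pr-scale zeros-additive α ⟩
      length (pr α) * zeros α     ≤⟨ *-monoʳ-≤ (length (pr α)) z≤w ⟩
      length (pr α) * weight α    ≡⟨ sym (pr-scale weight-additive α) ⟩
      length α * weight (pr α)    ≡⟨ cong (_* weight (pr α)) lα ⟩
      n * weight (pr α)           ∎

-- A controlled string: its excess is exactly T and the excess of every prefix lies in [−n, T + n].
record Controlled (n T : ℕ) (w : BinStr) : Set where
  field
    total-excess : weight w ≡ zeros w + T
    ones-bound   : OnesBounded (T + n) w
    zeros-bound  : OnesBounded n (complement w)

D-controlled : ∀ n e → suc n ≤ suc e + suc e → Controlled (suc n) (n C e) (D (suc e) (suc n))
D-controlled n e n≤2d = record { total-excess = D-excess n e ; ones-bound = ones-D ; zeros-bound = zeros-D }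
  where
  N = Necklaces (suc e) (suc n)
  blocks : All (λ b → zeros b ≤ weight b × length b ≤ suc n) (map pr N)
  blocks = AllProp.map⁺ (All.tabulate (pr-block (suc e) (suc n) (s≤s z≤n) n≤2d))
  excess-D : excess (D (suc e) (suc n)) ≡ n C e
  excess-D = trans (cong (_∸ zeros (D (suc e) (suc n))) (D-excess n e)) (m+n∸m≡n (zeros (D (suc e) (suc n))) (n C e))
  ones-D : OnesBounded (n C e + suc n) (D (suc e) (suc n))
  ones-D = subst (λ T → OnesBounded (T + suc n) (D (suc e) (suc n))) excess-D
           (nonnegative-blocks-bounded (suc n) (map pr N) blocks)
  complement-block : ∀ {b} → zeros b ≤ weight b × length b ≤ suc n →
                     weight (complement b) ≤ zeros (complement b) × length (complement b) ≤ suc n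
  complement-block {b} (z≤w , lb) =
    subst₂ _≤_ (sym (weight-complement b)) (sym (zeros-complement b)) z≤w , subst (_≤ suc n) (sym (length-map not b)) lb
  zeros-D : OnesBounded (suc n) (complement (D (suc e) (suc n)))
  zeros-D = subst (OnesBounded (suc n)) (concat-map {f = not} (map pr N))
    (nonpositive-blocks-bounded (suc n) (map complement (map pr N)) (AllProp.map⁺ (All.map (λ {b} → complement-block {b}) blocks)))

max-≥ : ∀ (f : BinStr → ℕ) xs {x} → x ∈ xs → f x ≤ foldr _⊔_ 0 (map f xs)
max-≥ f (y ∷ xs) (here refl) = m≤m⊔n (f y) _
max-≥ f (y ∷ xs) (there x∈) = ≤-trans (max-≥ f xs x∈) (m≤n⊔m (f y) _)

max-≤ : ∀ (f : BinStr → ℕ) xs {M} → (∀ {x} → x ∈ xs → f x ≤ M) → foldr _⊔_ 0 (map f xs) ≤ M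
max-≤ f []       bound = z≤n
max-≤ f (y ∷ xs) bound = ⊔-lub (bound (here refl)) (max-≤ f xs (bound ∘ there))

imbalance : BinStr → ℕ
imbalance u = ∣ weight u - zeros u ∣

substringsFrom : BinStr → ℕ → List BinStr
substringsFrom w i = map (λ l → take l (drop i (w ++ w))) (upTo (suc (length w)))

∈-circularSubstrings⁻ : ∀ w {u} → u ∈ circularSubstrings w → ∃ λ i → ∃ λ l → u ≡ take l (drop i (w ++ w))
∈-circularSubstrings⁻ w {u} u∈ =
  let i , _ , u∈ᵢ = find (∈-concatMap⁻ (substringsFrom w) {xs = upTo (length w)} {y = u} u∈)
      l , _ , u≡  = ∈-map⁻ (λ l → take l (drop i (w ++ w))) {xs = upTo (suc (length w))} u∈ᵢ
  in i , l , u≡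

∈-circularSubstrings⁺ : ∀ w i l → i < length w → l ≤ length w → take l (drop i (w ++ w)) ∈ circularSubstrings w
∈-circularSubstrings⁺ w i l i< l≤ =
  ∈-concatMap⁺ (substringsFrom w) (lose (∈-upTo⁺ i<) (∈-map⁺ (λ l → take l (drop i (w ++ w))) (∈-upTo⁺ (s≤s l≤))))

-- Every prefix of w is a circular substring, so its imbalance is at most disc w.
prefix-≤-disc : ∀ w l → l ≤ length w → imbalance (take l w) ≤ disc w
prefix-≤-disc []      zero    _  = z≤n
prefix-≤-disc (a ∷ w) l       l≤ =
  subst (λ u → imbalance u ≤ disc (a ∷ w)) (take-++-≤ l (a ∷ w) (a ∷ w) l≤)
    (max-≥ imbalance (circularSubstrings (a ∷ w)) (∈-circularSubstrings⁺ (a ∷ w) 0 l (s≤s z≤n) l≤))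

substring-ones : ∀ {L H} w → OnesBounded H w → OnesBounded L (complement w) →
                 ∀ i l → weight (take l (drop i w)) ≤ zeros (take l (drop i w)) + (L + H)
substring-ones {L} {H} w bnd bndC i l = +-cancelˡ-≤ (weight v) _ _ (begin
    weight v + weight u        ≡⟨ sym (Additive.h-++ weight-additive v u) ⟩
    weight (v ++ u)            ≤⟨ subst (λ z → weight z ≤ zeros z + H) (take-+ i l w) (bnd (i + l)) ⟩
    zeros (v ++ u) + H         ≡⟨ cong (_+ H) (Additive.h-++ zeros-additive v u) ⟩
    zeros v + zeros u + H      ≤⟨ +-monoˡ-≤ H (+-monoˡ-≤ (zeros u) zeros-v) ⟩
    weight v + L + zeros u + H ≡⟨ rearrange (weight v) L (zeros u) H ⟩
    weight v + (zeros u + (L + H)) ∎)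
  where
  open ≤-Reasoning
  v = take i w
  u = take l (drop i w)
  zeros-v : zeros v ≤ weight v + L
  zeros-v = subst₂ (λ a b → a ≤ b + L) (weight-complement v) (zeros-complement v)
              (subst (λ z → weight z ≤ zeros z + L) (take-map i w) (bndC i))
  rearrange : ∀ a b c d → a + b + c + d ≡ a + (c + (b + d))
  rearrange = solve-∀

imbalance-≤ : ∀ a b c → a ≤ b + c → b ≤ a + c → ∣ a - b ∣ ≤ c
imbalance-≤ a b c a≤ b≤ with ≤-total a b
... | inj₁ a≤b = subst (_≤ c) (sym (m≤n⇒∣m-n∣≡n∸m a≤b)) (m≤n+o⇒m∸n≤o b a b≤)
... | inj₂ b≤a = subst (_≤ c) (sym (m≤n⇒∣n-m∣≡n∸m b≤a)) (m≤n+o⇒m∸n≤o a b a≤)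

-- A balanced string whose prefixes exceed by at most H ones and L zeros has
-- discrepancy at most L + H: its circular substrings are substrings of w w,
-- which obeys the same prefix bounds.
disc-≤ : ∀ {L H} w → weight w ≡ zeros w → OnesBounded H w → OnesBounded L (complement w) → disc w ≤ L + H
disc-≤ {L} {H} w balanced bnd bndC = max-≤ imbalance (circularSubstrings w) bound
  where
  ww = w ++ w
  bnd² : OnesBounded H ww
  bnd² = ones-bounded-++ w w bnd bnd ≤-refl (≤-reflexive (cong (_+ H) balanced))
  bndC² : OnesBounded L (complement ww)
  bndC² = subst (OnesBounded L) (sym (complement-++ w w))
            (ones-bounded-++ (complement w) (complement w) bndC bndC ≤-refl
              (≤-reflexive (cong (_+ L) (trans (weight-complement w) (trans (sym balanced) (sym (zeros-complement w)))))))
  bound : ∀ {u} → u ∈ circularSubstrings w → imbalance u ≤ L + H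
  bound u∈ with ∈-circularSubstrings⁻ w u∈
  ... | i , l , refl = imbalance-≤ (weight u) (zeros u) (L + H) (substring-ones ww bnd² bndC² i l) zeros-u
    where
    u = take l (drop i ww)
    complement-u : complement u ≡ take l (drop i (complement ww))
    complement-u = sym (trans (cong (take l) (drop-map i ww)) (take-map l (drop i ww)))
    zeros-u : zeros u ≤ weight u + (L + H)
    zeros-u = begin
        zeros u                         ≡⟨ sym (weight-complement u) ⟩
        weight (complement u)           ≡⟨ cong weight complement-u ⟩
        weight u'                       ≤⟨ substring-ones (complement ww) bndC² bnd²' i l ⟩
        zeros u' + (H + L)              ≡⟨ cong₂ _+_ (trans (cong zeros (sym complement-u)) (zeros-complement u)) (+-comm H L) ⟩
        weight u + (L + H)              ∎
      where
      open ≤-Reasoning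
      u' = take l (drop i (complement ww))
      bnd²' : OnesBounded H (complement (complement ww))
      bnd²' = subst (OnesBounded H) (sym (complement-involutive ww)) bnd²

module _ {n T P Q} (ctrlP : Controlled n T P) (ctrlQ : Controlled n T Q) (k : ℕ) (short : length (drop k Q) ≤ n) where

  private
    module P = Controlled ctrlP
    module Q = Controlled ctrlQ
    X = complement P
    Y = rotate k Q
    s = drop k Q
    t = take k Q

  rotated-ones : OnesBounded (T + (n + n)) Y
  rotated-ones = ones-bounded-++ s t (short-bounded n s short) (ones-bounded-take k Q Q.ones-bound)
    (≤-trans (m≤m+n n n) (m≤n+m (n + n) T))
    (≤-trans (+-monoˡ-≤ (T + n) (short-excess n s short)) (≤-reflexive (rearrange (zeros s) n T)))
    where
    rearrange : ∀ a b c → a + b + (c + b) ≡ a + (c + (b + b))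
    rearrange = solve-∀

  rotated-zeros : OnesBounded (n + n) (complement Y)
  rotated-zeros = subst (OnesBounded (n + n)) (sym (complement-++ s t))
    (ones-bounded-++ (complement s) (complement t) (short-bounded n (complement s) short')
      (subst (OnesBounded n) (take-map k Q) (ones-bounded-take k (complement Q) Q.zeros-bound))
      (m≤m+n n n)
      (≤-trans (+-monoˡ-≤ n (short-excess n (complement s) short')) (≤-reflexive (+-assoc _ n n))))
    where
    short' : length (complement s) ≤ n
    short' = subst (_≤ n) (sym (length-map not s)) short

  private
    weight-X : weight X ≡ zeros P
    weight-X = weight-complement P
    zeros-X : zeros X ≡ zeros P + T
    zeros-X = trans (zeros-complement P) P.total-excess

  balanced : weight (X ++ Y) ≡ zeros (X ++ Y)
  balanced = begin
      weight (X ++ Y)             ≡⟨ Additive.h-++ weight-additive X Y ⟩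
      weight X + weight Y         ≡⟨ cong₂ _+_ weight-X (trans (additive-rotate weight-additive k Q) Q.total-excess) ⟩
      zeros P + (zeros Q + T)     ≡⟨ rearrange (zeros P) (zeros Q) T ⟩
      (zeros P + T) + zeros Q     ≡⟨ cong₂ _+_ (sym zeros-X) (sym (additive-rotate zeros-additive k Q)) ⟩
      zeros X + zeros Y           ≡⟨ sym (Additive.h-++ zeros-additive X Y) ⟩
      zeros (X ++ Y)              ∎
    where
    open ≡-Reasoning
    rearrange : ∀ a b c → a + (b + c) ≡ (a + c) + b
    rearrange = solve-∀

  disc-upper : disc (X ++ Y) ≤ (T + (n + n)) + (n + n)
  disc-upper = disc-≤ (X ++ Y) balanced ones-XY zeros-XY
    where
    ones-XY : OnesBounded (n + n) (X ++ Y)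
    ones-XY = ones-bounded-++ X Y P.zeros-bound rotated-ones (m≤m+n n n)
      (≤-reflexive (trans (cong (_+ (T + (n + n))) weight-X)
                   (trans (sym (+-assoc (zeros P) T (n + n))) (cong (_+ (n + n)) (sym zeros-X)))))
    zeros-XY : OnesBounded (T + (n + n)) (complement (X ++ Y))
    zeros-XY = subst (OnesBounded (T + (n + n))) (sym (complement-++ X Y))
      (ones-bounded-++ (complement X) (complement Y)
        (subst (OnesBounded (T + n)) (sym (complement-involutive P)) P.ones-bound)
        rotated-zeros (+-monoʳ-≤ T (m≤m+n n n))
        (≤-reflexive (begin
          weight (complement X) + (n + n)  ≡⟨ cong (_+ (n + n)) (trans (weight-complement X) zeros-X) ⟩
          zeros P + T + (n + n)            ≡⟨ +-assoc (zeros P) T (n + n) ⟩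
          zeros P + (T + (n + n))          ≡⟨ cong (_+ (T + (n + n))) (sym (trans (zeros-complement X) weight-X)) ⟩
          zeros (complement X) + (T + (n + n)) ∎)))
      where open ≡-Reasoning

  -- The prefix X alone already has imbalance T.
  disc-lower : T ≤ disc (X ++ Y)
  disc-lower = subst (_≤ disc (X ++ Y)) imbalance-X
    (subst (λ u → imbalance u ≤ disc (X ++ Y)) (take-length-++ X Y)
      (prefix-≤-disc (X ++ Y) (length X) (subst (length X ≤_) (sym (length-++ X)) (m≤m+n (length X) (length Y)))))
    where
    imbalance-X : imbalance X ≡ T
    imbalance-X = trans (cong₂ ∣_-_∣ weight-X zeros-X) (∣m-m+n∣≡n (zeros P) T)

absorption : ∀ n k → suc k * (suc n C suc k) ≡ suc n * (n C k)
absorption zero    zero    = refl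
absorption zero    (suc k) = begin
    2+ k * (1 C 2+ k)     ≡⟨ cong (2+ k *_) (k>n⇒nCk≡0 {1} {2+ k} (s≤s (s≤s z≤n))) ⟩
    2+ k * 0              ≡⟨ *-zeroʳ (2+ k) ⟩
    0                     ≡⟨ sym (k>n⇒nCk≡0 {0} {suc k} (s≤s z≤n)) ⟩
    1 * (0 C suc k)       ∎
  where open ≡-Reasoning
absorption (suc n) zero = begin
    1 * (2+ n C 1)        ≡⟨ *-identityˡ _ ⟩
    2+ n C 1              ≡⟨ nC1≡n (2+ n) ⟩
    2+ n                  ≡⟨ sym (*-identityʳ (2+ n)) ⟩
    2+ n * 1              ≡⟨ cong (2+ n *_) (sym (nC0≡1 (suc n))) ⟩
    2+ n * (suc n C 0)    ∎
  where open ≡-Reasoning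
absorption (suc n) (suc j) = begin
    2+ j * (2+ n C 2+ j)                        ≡⟨ cong (2+ j *_) (sym (nCk+nC[k+1]≡[n+1]C[k+1] (suc n) (suc j))) ⟩
    2+ j * (a + b)                              ≡⟨ rearrange j a b ⟩
    a + (suc j * a + 2+ j * b)                  ≡⟨ cong (a +_) (cong₂ _+_ (absorption n j) (absorption n (suc j))) ⟩
    a + (suc n * (n C j) + suc n * (n C suc j)) ≡⟨ cong (a +_) (sym (*-distribˡ-+ (suc n) (n C j) (n C suc j))) ⟩
    a + suc n * (n C j + n C suc j)             ≡⟨ cong (λ z → a + suc n * z) (nCk+nC[k+1]≡[n+1]C[k+1] n j) ⟩
    a + suc n * a                               ∎
  where
  open ≡-Reasoning
  a = suc n C suc j
  b = suc n C 2+ j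
  rearrange : ∀ j a b → 2+ j * (a + b) ≡ a + (suc j * a + 2+ j * b)
  rearrange = solve-∀

central odd-central : ℕ → ℕ
central m     = (m + m) C m
odd-central m = suc (m + m) C suc m

odd-central-sym : ∀ m → suc (m + m) C m ≡ odd-central m
odd-central-sym m = trans (nCk≡nC[n∸k] {m} {suc (m + m)} (≤-trans (m≤m+n m m) (n≤1+n _))) (cong (suc (m + m) C_) 1+2m∸m)
  where
  1+2m∸m : suc (m + m) ∸ m ≡ suc m
  1+2m∸m = trans (+-∸-assoc 1 {m + m} {m} (m≤m+n m m)) (cong suc (m+n∸n≡m m m))

odd-central-rec : ∀ m → suc m * odd-central m ≡ suc (m + m) * central m
odd-central-rec m = absorption (m + m) m

central-suc : ∀ m → central (suc m) ≡ 2 * odd-central m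
central-suc m = *-cancelˡ-≡ _ _ (suc m) (begin
    suc m * central (suc m)                  ≡⟨ cong (λ z → suc m * (z C suc m)) (cong suc (+-suc m m)) ⟩
    suc m * (2+ (m + m) C suc m)             ≡⟨ absorption (suc (m + m)) m ⟩
    2+ (m + m) * (suc (m + m) C m)           ≡⟨ cong (2+ (m + m) *_) (odd-central-sym m) ⟩
    2+ (m + m) * odd-central m               ≡⟨ rearrange m (odd-central m) ⟩
    suc m * (2 * odd-central m)              ∎)
  where
  open ≡-Reasoning
  rearrange : ∀ m x → 2+ (m + m) * x ≡ suc m * (2 * x)
  rearrange = solve-∀

central-ratio : ∀ m → suc m * central (suc m) ≡ 2 * (suc (m + m) * central m)
central-ratio m = begin
    suc m * central (suc m)           ≡⟨ cong (suc m *_) (central-suc m) ⟩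
    suc m * (2 * odd-central m)       ≡⟨ rearrange (suc m) (odd-central m) ⟩
    2 * (suc m * odd-central m)       ≡⟨ cong (2 *_) (odd-central-rec m) ⟩
    2 * (suc (m + m) * central m)     ∎
  where
  open ≡-Reasoning
  rearrange : ∀ x y → x * (2 * y) ≡ 2 * (x * y)
  rearrange = solve-∀

sq : ℕ → ℕ
sq x = x * x

-- (2m+1) c_m² ≤ 16^m, by induction via the ratio recurrence and (2m+3)(2m+1) ≤ 4(m+1)².
central-upper : ∀ m → suc (m + m) * sq (central m) ≤ 16 ^ m
central-upper zero    = ≤-refl
central-upper (suc m) = *-cancelˡ-≤ (sq (suc m)) (begin
    sq (suc m) * (s₁ * sq (central (suc m)))      ≡⟨ rearrange₁ (suc m) s₁ (central (suc m)) ⟩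
    s₁ * sq (suc m * central (suc m))             ≡⟨ cong (λ z → s₁ * sq z) (central-ratio m) ⟩
    s₁ * sq (2 * (s₀ * central m))                ≡⟨ rearrange₂ m (central m) ⟩
    (4 * (s₁ * s₀)) * (s₀ * sq (central m))       ≤⟨ *-monoʳ-≤ (4 * (s₁ * s₀)) (central-upper m) ⟩
    (4 * (s₁ * s₀)) * 16 ^ m                      ≤⟨ *-monoˡ-≤ (16 ^ m) (*-monoʳ-≤ 4 product-≤) ⟩
    (4 * (4 * sq (suc m))) * 16 ^ m               ≡⟨ rearrange₃ (suc m) (16 ^ m) ⟩
    sq (suc m) * 16 ^ suc m                       ∎)
  where
  open ≤-Reasoning
  s₀ = suc (m + m)
  s₁ = suc (suc m + suc m)
  product-≤ : s₁ * s₀ ≤ 4 * sq (suc m)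
  product-≤ = ≤-trans (m≤m+n _ 1) (≤-reflexive (identity m))
    where
    identity : ∀ m → suc (suc m + suc m) * suc (m + m) + 1 ≡ 4 * (suc m * suc m)
    identity = solve-∀
  rearrange₁ : ∀ x y z → (x * x) * (y * (z * z)) ≡ y * ((x * z) * (x * z))
  rearrange₁ = solve-∀
  rearrange₂ : ∀ m z → suc (suc m + suc m) * ((2 * (suc (m + m) * z)) * (2 * (suc (m + m) * z)))
                       ≡ (4 * (suc (suc m + suc m) * suc (m + m))) * (suc (m + m) * (z * z))
  rearrange₂ = solve-∀
  rearrange₃ : ∀ x y → (4 * (4 * (x * x))) * y ≡ (x * x) * (16 * y)
  rearrange₃ = solve-∀

central-lower : ∀ m → 16 ^ suc m ≤ 4 * (suc m * sq (central (suc m)))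
central-lower zero    = ≤-refl
central-lower (suc m) = *-cancelˡ-≤ (sq (2+ m)) (begin
    sq (2+ m) * 16 ^ 2+ m                             ≡⟨ rearrange₁ (2+ m) (16 ^ suc m) ⟩
    (16 * sq (2+ m)) * 16 ^ suc m                     ≤⟨ *-monoʳ-≤ (16 * sq (2+ m)) (central-lower m) ⟩
    (16 * sq (2+ m)) * (4 * (suc m * sq c₁))          ≡⟨ rearrange₂ (2+ m) (suc m) c₁ ⟩
    (16 * 2+ m) * ((4 * (2+ m * suc m)) * sq c₁)      ≤⟨ *-monoʳ-≤ (16 * 2+ m) (*-monoˡ-≤ (sq c₁) product-≤) ⟩
    (16 * 2+ m) * (sq s₁ * sq c₁)                     ≡⟨ rearrange₃ (2+ m) s₁ c₁ ⟩
    4 * 2+ m * sq (2 * (s₁ * c₁))                     ≡⟨ cong (λ z → 4 * 2+ m * sq z) (sym (central-ratio (suc m))) ⟩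
    4 * 2+ m * sq (2+ m * central (2+ m))             ≡⟨ rearrange₄ (2+ m) (central (2+ m)) ⟩
    sq (2+ m) * (4 * (2+ m * sq (central (2+ m))))    ∎)
  where
  open ≤-Reasoning
  c₁ = central (suc m)
  s₁ = suc (suc m + suc m)
  product-≤ : 4 * (2+ m * suc m) ≤ sq s₁
  product-≤ = ≤-trans (m≤m+n _ 1) (≤-reflexive (identity m))
    where
    identity : ∀ m → 4 * (2+ m * suc m) + 1 ≡ suc (suc m + suc m) * suc (suc m + suc m)
    identity = solve-∀
  rearrange₁ : ∀ x y → (x * x) * (16 * y) ≡ (16 * (x * x)) * y
  rearrange₁ = solve-∀
  rearrange₂ : ∀ x y z → (16 * (x * x)) * (4 * (y * (z * z))) ≡ (16 * x) * ((4 * (x * y)) * (z * z))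
  rearrange₂ = solve-∀
  rearrange₃ : ∀ x y z → (16 * x) * ((y * y) * (z * z)) ≡ 4 * x * ((2 * (y * z)) * (2 * (y * z)))
  rearrange₃ = solve-∀
  rearrange₄ : ∀ x y → 4 * x * ((x * y) * (x * y)) ≡ (x * x) * (4 * (x * (y * y)))
  rearrange₄ = solve-∀

CentralEstimate : ℕ → ℕ → Set
CentralEstimate N T = (4 ^ N ≤ 8 * (N * sq T)) × (N * sq T ≤ 4 ^ N)

4^[m+m]≡16^m : ∀ m → 4 ^ (m + m) ≡ 16 ^ m
4^[m+m]≡16^m zero    = refl
4^[m+m]≡16^m (suc m) = begin
    4 ^ suc (m + suc m)    ≡⟨ cong (λ z → 4 ^ suc z) (+-suc m m) ⟩
    4 * (4 * 4 ^ (m + m))  ≡⟨ sym (*-assoc 4 4 (4 ^ (m + m))) ⟩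
    16 * 4 ^ (m + m)       ≡⟨ cong (16 *_) (4^[m+m]≡16^m m) ⟩
    16 ^ suc m             ∎
  where open ≡-Reasoning

odd-estimate : ∀ m → CentralEstimate (suc (m + m)) (central m)
odd-estimate m = lower m , ≤-trans (central-upper m) (≤-trans (≤-reflexive (sym (4^[m+m]≡16^m m))) (m≤n*m (4 ^ (m + m)) 4))
  where
  lower : ∀ m → 4 ^ suc (m + m) ≤ 8 * (suc (m + m) * sq (central m))
  lower zero    = s≤s (s≤s (s≤s (s≤s z≤n)))
  lower (suc k) = begin
      4 * 4 ^ (suc k + suc k)                   ≡⟨ cong (4 *_) (4^[m+m]≡16^m (suc k)) ⟩
      4 * 16 ^ suc k                            ≤⟨ *-monoʳ-≤ 4 (central-lower k) ⟩
      4 * (4 * (suc k * sq c))                  ≤⟨ m≤m+n _ (8 * sq c) ⟩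
      4 * (4 * (suc k * sq c)) + 8 * sq c       ≡⟨ rearrange k (sq c) ⟩
      8 * (suc (suc k + suc k) * sq c)          ∎
    where
    open ≤-Reasoning
    c = central (suc k)
    rearrange : ∀ k x → 4 * (4 * (suc k * x)) + 8 * x ≡ 8 * (suc (suc k + suc k) * x)
    rearrange = solve-∀

even-estimate : ∀ m → CentralEstimate (2+ (m + m)) (odd-central m)
even-estimate m = lower , upper
  where
  open ≤-Reasoning
  b = odd-central m
  4^N≡16^[m+1] : 4 ^ 2+ (m + m) ≡ 16 ^ suc m
  4^N≡16^[m+1] = trans (cong (λ z → 4 ^ suc z) (sym (+-suc m m))) (4^[m+m]≡16^m (suc m))
  sq-central : sq (central (suc m)) ≡ 4 * sq b
  sq-central = trans (cong sq (central-suc m)) (rearrange b)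
    where
    rearrange : ∀ x → (2 * x) * (2 * x) ≡ 4 * (x * x)
    rearrange = solve-∀
  lower = begin
      4 ^ 2+ (m + m)                    ≡⟨ 4^N≡16^[m+1] ⟩
      16 ^ suc m                        ≤⟨ central-lower m ⟩
      4 * (suc m * sq (central (suc m))) ≡⟨ cong (λ z → 4 * (suc m * z)) sq-central ⟩
      4 * (suc m * (4 * sq b))          ≡⟨ rearrange m (sq b) ⟩
      8 * (2+ (m + m) * sq b)           ∎
    where
    rearrange : ∀ m x → 4 * (suc m * (4 * x)) ≡ 8 * (2+ (m + m) * x)
    rearrange = solve-∀
  upper = begin
      2+ (m + m) * sq b                        ≤⟨ m≤n*m _ 4 ⟩
      4 * (2+ (m + m) * sq b)                  ≡⟨ rearrange m (sq b) ⟩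
      2+ (m + m) * (4 * sq b)                  ≡⟨ cong (2+ (m + m) *_) (sym sq-central) ⟩
      2+ (m + m) * sq (central (suc m))        ≤⟨ *-monoˡ-≤ (sq (central (suc m))) (≤-trans (n≤1+n _) (≤-reflexive (cong 2+ (sym (+-suc m m))))) ⟩
      suc (suc m + suc m) * sq (central (suc m)) ≤⟨ central-upper (suc m) ⟩
      16 ^ suc m                               ≡⟨ sym 4^N≡16^[m+1] ⟩
      4 ^ 2+ (m + m)                           ∎
    where
    rearrange : ∀ m x → 4 * (2+ (m + m) * x) ≡ 2+ (m + m) * (4 * x)
    rearrange = solve-∀

parity : ∀ n → ∃ λ m → (n ≡ m + m) ⊎ (n ≡ suc (m + m))
parity zero    = 0 , inj₁ refl
parity (suc n) with parity n
... | m , inj₁ n≡ = m , inj₂ (cong suc n≡)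
... | m , inj₂ n≡ = suc m , inj₁ (trans (cong suc n≡) (cong suc (sym (+-suc m m))))

central-estimate : ∀ n → CentralEstimate (suc n) (n C ⌊ suc n /2⌋)
central-estimate n with parity n
... | m , inj₁ refl = subst (λ k → CentralEstimate (suc (m + m)) ((m + m) C k)) (n≡⌈n+n/2⌉ m) (odd-estimate m)
... | m , inj₂ refl = subst (λ k → CentralEstimate (2+ (m + m)) (suc (m + m) C suc k)) (n≡⌊n+n/2⌋ m) (even-estimate m)

n≤1+2⌊n/2⌋ : ∀ n → n ≤ suc (⌊ n /2⌋ + ⌊ n /2⌋)
n≤1+2⌊n/2⌋ zero          = z≤n
n≤1+2⌊n/2⌋ (suc zero)    = ≤-refl
n≤1+2⌊n/2⌋ (suc (suc n)) = s≤s (≤-trans (s≤s (n≤1+2⌊n/2⌋ n)) (≤-reflexive (cong suc (sym (+-suc ⌊ n /2⌋ ⌊ n /2⌋)))))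

-- DB_max(n+1) is the complement of D_{e+1}(n+1), e = ⌊(n+1)/2⌋, followed by a
-- rotation of D_{e'+1}(n+1), e' = ⌊n/2⌋.  Both are controlled with the same
-- excess T = C(n, e) = C(n, e'), so the discrepancy lies between T and T + 4(n+1).
DBmax-sandwich : ∀ n → let T = n C ⌊ suc n /2⌋ ; N = suc n in
                 T ≤ disc (DBmax N) × disc (DBmax N) ≤ (T + (N + N)) + (N + N)
DBmax-sandwich n = disc-lower ctrlP ctrlQ k short , disc-upper ctrlP ctrlQ k short
  where
  e  = ⌊ suc n /2⌋
  e' = ⌊ n /2⌋
  Q  = D (suc e') (suc n)
  k  = length Q ∸ e'
  symmetric : n C e' ≡ n C e
  symmetric = trans (nCk≡nC[n∸k] (⌊n/2⌋≤n n))
                (cong (n C_) (trans (cong (_∸ e') (sym (⌊n/2⌋+⌈n/2⌉≡n n))) (m+n∸m≡n e' ⌈ n /2⌉)))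
  ctrlP = D-controlled n e (≤-trans (n≤1+2⌊n/2⌋ (suc n)) (s≤s (+-monoʳ-≤ e (n≤1+n e))))
  ctrlQ = subst (λ T → Controlled (suc n) T Q) symmetric
            (D-controlled n e' (s≤s (≤-trans (n≤1+2⌊n/2⌋ n) (≤-reflexive (sym (+-suc e' e'))))))
  short : length (drop k Q) ≤ suc n
  short = begin
      length (drop k Q)        ≡⟨ length-drop k Q ⟩
      length Q ∸ k             ≤⟨ m≤n+o⇒m∸n≤o (length Q) k (≤-trans (m≤n+m∸n (length Q) e') (≤-reflexive (+-comm e' _))) ⟩
      e'                       ≤⟨ ⌊n/2⌋≤n n ⟩
      n                        ≤⟨ n≤1+n n ⟩
      suc n                    ∎
    where open ≤-Reasoning

-- 2xy ≤ x² + y²: for x ≤ y write y = x + o, then x² + y² = 2xy + o².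
twice-product-≤-ordered : ∀ x y → x ≤ y → 2 * (x * y) ≤ x * x + y * y
twice-product-≤-ordered x y x≤y with m≤n⇒∃[o]m+o≡n x≤y
... | o , refl = ≤-trans (m≤m+n _ (o * o)) (≤-reflexive (identity x o))
  where
  identity : ∀ x o → 2 * (x * (x + o)) + o * o ≡ x * x + (x + o) * (x + o)
  identity = solve-∀

twice-product-≤ : ∀ x y → 2 * (x * y) ≤ x * x + y * y
twice-product-≤ x y with ≤-total x y
... | inj₁ x≤y = twice-product-≤-ordered x y x≤y
... | inj₂ y≤x = subst₂ _≤_ (cong (2 *_) (*-comm y x)) (+-comm (y * y) (x * x)) (twice-product-≤-ordered y x y≤x)

cube-≤ : ∀ n → n * (n * n) ≤ 4 ^ n
cube-≤ zero                = z≤n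
cube-≤ (suc zero)          = s≤s z≤n
cube-≤ (suc (suc zero))    = s≤s (s≤s (s≤s (s≤s (s≤s (s≤s (s≤s (s≤s z≤n)))))))
cube-≤ (suc (suc (suc k))) =
  ≤-trans (≤-trans (m≤m+n _ _) (≤-reflexive (identity k))) (*-monoʳ-≤ 4 (cube-≤ (suc (suc k))))
  where
  identity : ∀ k → suc (suc (suc k)) * (suc (suc (suc k)) * suc (suc (suc k))) + (3 * (k * (k * k)) + 15 * (k * k) + 21 * k + 5)
                   ≡ 4 * (suc (suc k) * (suc (suc k) * suc (suc k)))
  identity = solve-∀

-- If T ≤ δ ≤ T + 4N and N T² is within a factor 8 of 4^N, then N δ² is within
-- the factors 8 and 34 of 4^N: (T + 4N)² ≤ 2T² + 32N² and N³ ≤ 4^N.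
transfer-estimate : ∀ N T δ → T ≤ δ → δ ≤ (T + (N + N)) + (N + N) → CentralEstimate N T →
                    (4 ^ N ≤ 8 * (N * (δ * δ))) × (N * (δ * δ) ≤ 34 * 4 ^ N)
transfer-estimate N T δ T≤δ δ≤ (lower , upper) = δ-lower , δ-upper
  where
  open ≤-Reasoning
  M = 4 * N
  δ-lower : 4 ^ N ≤ 8 * (N * (δ * δ))
  δ-lower = ≤-trans lower (*-monoʳ-≤ 8 (*-monoʳ-≤ N (*-mono-≤ T≤δ T≤δ)))
  δ≤T+M : δ ≤ T + M
  δ≤T+M = ≤-trans δ≤ (≤-reflexive (identity T N))
    where
    identity : ∀ T N → (T + (N + N)) + (N + N) ≡ T + 4 * N
    identity = solve-∀
  square-≤ : (T + M) * (T + M) ≤ 2 * (T * T) + 2 * (M * M)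
  square-≤ = ≤-trans (≤-reflexive (expand² T M))
               (≤-trans (+-monoʳ-≤ (T * T + M * M) (twice-product-≤ T M)) (≤-reflexive (regroup T M)))
    where
    expand² : ∀ a b → (a + b) * (a + b) ≡ (a * a + b * b) + 2 * (a * b)
    expand² = solve-∀
    regroup : ∀ a b → (a * a + b * b) + (a * a + b * b) ≡ 2 * (a * a) + 2 * (b * b)
    regroup = solve-∀
  expand : ∀ N T → N * (2 * (T * T) + 2 * ((4 * N) * (4 * N))) ≡ 2 * (N * (T * T)) + 32 * (N * (N * N))
  expand = solve-∀
  δ-upper : N * (δ * δ) ≤ 34 * 4 ^ N
  δ-upper = begin
    N * (δ * δ)                          ≤⟨ *-monoʳ-≤ N (*-mono-≤ δ≤T+M δ≤T+M) ⟩
    N * ((T + M) * (T + M))              ≤⟨ *-monoʳ-≤ N square-≤ ⟩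
    N * (2 * (T * T) + 2 * (M * M))      ≡⟨ expand N T ⟩
    2 * (N * (T * T)) + 32 * (N * (N * N)) ≤⟨ +-mono-≤ (*-monoʳ-≤ 2 upper) (*-monoʳ-≤ 32 (cube-≤ N)) ⟩
    2 * 4 ^ N + 32 * 4 ^ N               ≡⟨ sym (*-distribʳ-+ (4 ^ N) 2 32) ⟩
    34 * 4 ^ N                           ∎

corollary2 : Σ ℕ λ A → Σ ℕ λ B → Σ ℕ λ N →
    NonZero A × NonZero B ×
    ((n : ℕ) → n ≥ N →
    (4 ^ n ≤ A * (n * (disc (DBmax n) * disc (DBmax n))))
    × (n * (disc (DBmax n) * disc (DBmax n)) ≤ B * 4 ^ n))
corollary2 = 8 , 34 , 1 , _ , _ , bounds
  where
  bounds : ∀ n → n ≥ 1 → (4 ^ n ≤ 8 * (n * (disc (DBmax n) * disc (DBmax n))))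
                         × (n * (disc (DBmax n) * disc (DBmax n)) ≤ 34 * 4 ^ n)
  bounds (suc n) _ = let lower , upper = DBmax-sandwich n in
    transfer-estimate (suc n) (n C ⌊ suc n /2⌋) (disc (DBmax (suc n))) lower upper (central-estimate n)
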